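{- For every rational number $t$ with $t\neq 1$ and $t\neq -1/3$, the number $$\frac{2}{3}\cdot\frac{3t^2-1}{(3t+1)(t-1)}$$ is not the square of a rational number. -}

module Defs where

open import Data.Rational using (ℚ; 0ℚ; _*_; _÷_; _≟_; ≢-nonZero)
open import Relation.Nullary using (yes; no)

-- Total division on ℚ: p ⊘ q = p / q when q ≠ 0 (and 0 when q = 0; that
-- case never arises in the statement, where denominators are nonzero).
_⊘_ : ℚ → ℚ → ℚ
p ⊘ q with q ≟ 0ℚ
... | yes _ = 0ℚ
... | no q≢0 = (p ÷ q) {{≢-nonZero q≢0}}

infixl 7 _⊘_

-- Write t = a / B and q = m / N. Clearing denominators, a solution is a point of the curve
-- 3m²(3a + B)(a − B) = 2N²(3a² − B²), and a change of variables turns it into R² = F(M, K) with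
-- F(m, k) = m⁴ − 9m²k² + 27k⁴ and K = N(a − B) ≠ 0.
--
-- F(m, k) is never a square for k ≠ 0, by infinite descent through the 2-isogenous quartic
-- G(g, h) = g⁴ + 18g²h² − 27h⁴. For a primitive solution R² = F(m, k), m is odd and prime to 3, and
-- 4R² − (2m² − 9k²)² = 27k⁴ (for even k = 2y, R² − (m² − 18y²)² = 108y⁴) writes 27k⁴ or 27y⁴ as a product of two
-- coprime positive factors, which must be g⁴ and 27h⁴. One arrangement is impossible modulo 3, the other gives
-- X² = G(g, h) with g⁴ < 4R. In the same way (g² + 9h²)² − X² = 108h⁴ gives g² = F(g₁, h₁), a solution with g < R.
-- Congruences modulo 2, 4, 8 and 16 supply the parities that make the factors integral and coprime.

module Submission where

module CoprimeFactorisation where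

  open import Data.Empty using (⊥-elim)
  open import Data.Product using (∃₂; _,_; _×_)
  open import Data.Sum using (_⊎_; inj₁; inj₂)
  open import Relation.Binary.PropositionalEquality
  open import Relation.Binary.Definitions using (tri<; tri≈; tri>)
  open import Relation.Nullary using (¬_)
  open import Relation.Nullary.Decidable using (toWitness)

  open import Data.Nat using (ℕ; zero; suc; _+_; _*_; _^_; _/_; NonZero; ≢-nonZero; ≢-nonZero⁻¹)
  open import Data.Nat.Properties
  open import Data.Nat.Divisibility
  open import Data.Nat.DivMod using (m/n*n≡m)
  open import Data.Nat.GCD using (gcd; gcd[m,n]∣m; gcd[m,n]∣n; gcd[m,n]≢0)
  open import Data.Nat.Coprimality as Coprimality using (Coprime; coprime-divisor; coprime-/gcd)
  open import Data.Nat.Primality using (Prime; prime?; prime⇒irreducible; euclidsLemma)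
  open import Data.Nat.Tactic.RingSolver using (solve-∀)

  coprime-∣ʳ : ∀ {a b c} → Coprime a b → c ∣ b → Coprime a c
  coprime-∣ʳ a⊥b c∣b (d∣a , d∣c) = a⊥b (d∣a , ∣-trans d∣c c∣b)

  coprime-*ʳ : ∀ {a b c} → Coprime a b → Coprime a c → Coprime a (b * c)
  coprime-*ʳ a⊥b a⊥c (d∣a , d∣bc) =
    a⊥c (d∣a , coprime-divisor (Coprimality.sym (coprime-∣ʳ (Coprimality.sym a⊥b) d∣a)) d∣bc)

  coprime-*ˡ : ∀ {a b c} → Coprime a c → Coprime b c → Coprime (a * b) c
  coprime-*ˡ a⊥c b⊥c = Coprimality.sym (coprime-*ʳ (Coprimality.sym a⊥c) (Coprimality.sym b⊥c))

  coprime-^ʳ : ∀ {a b} n → Coprime a b → Coprime a (b ^ n)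
  coprime-^ʳ zero    a⊥b (_ , d∣1) = ∣1⇒≡1 d∣1
  coprime-^ʳ (suc n) a⊥b = coprime-*ʳ a⊥b (coprime-^ʳ n a⊥b)

  ¬∣⇒coprime : ∀ {p m} → Prime p → ¬ p ∣ m → Coprime m p
  ¬∣⇒coprime p-prime p∤m (d∣m , d∣p) with prime⇒irreducible p-prime d∣p
  ... | inj₁ d≡1  = d≡1
  ... | inj₂ refl = ⊥-elim (p∤m d∣m)

  prime-3 : Prime 3
  prime-3 = toWitness {a? = prime? 3} _

  ^-distribʳ-* : ∀ a b n → (a * b) ^ n ≡ a ^ n * b ^ n
  ^-distribʳ-* a b zero    = refl
  ^-distribʳ-* a b (suc n) = begin
    a * b * (a * b) ^ n     ≡⟨ cong (a * b *_) (^-distribʳ-* a b n) ⟩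
    a * b * (a ^ n * b ^ n) ≡⟨ interchange a b (a ^ n) (b ^ n) ⟩
    a * a ^ n * (b * b ^ n) ∎
    where
    open ≡-Reasoning
    interchange : ∀ w x y z → w * x * (y * z) ≡ w * y * (x * z)
    interchange = solve-∀

  ^-injectiveˡ : ∀ {a b} n → a ^ suc n ≡ b ^ suc n → a ≡ b
  ^-injectiveˡ {a} {b} n eq with <-cmp a b
  ... | tri< a<b _ _ = ⊥-elim (<-irrefl eq (^-monoˡ-< (suc n) a<b))
  ... | tri≈ _ a≡b _ = a≡b
  ... | tri> _ _ a>b = ⊥-elim (<-irrefl (sym eq) (^-monoˡ-< (suc n) a>b))

  -- a / g and b / g are coprime for g = gcd a b, so a / g ∣ (b / g)ⁿ⁺¹ forces a / g = 1.
  ^-cancel-∣ : ∀ {a b} n → a ^ suc n ∣ b ^ suc n → a ∣ b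
  ^-cancel-∣ {zero} {b} n 0∣bⁿ⁺¹ = subst (0 ∣_) (sym (m^n≡0⇒m≡0 b (suc n) (0∣⇒≡0 0∣bⁿ⁺¹))) ∣-refl
  ^-cancel-∣ {a@(suc _)} {b} n aⁿ⁺¹∣bⁿ⁺¹ = subst (_∣ b) g≡a (gcd[m,n]∣n a b)
    where
    g = gcd a b
    instance
      g≢0 : NonZero g
      g≢0 = ≢-nonZero (gcd[m,n]≢0 a b (inj₁ λ ()))
    split : ∀ x → x / g * g ≡ x → x ^ suc n ≡ (x / g) ^ suc n * g ^ suc n
    split x x≡ = trans (cong (_^ suc n) (sym x≡)) (^-distribʳ-* (x / g) g (suc n))
    a≡ : a / g * g ≡ a
    a≡ = m/n*n≡m (gcd[m,n]∣m a b)
    a′ⁿ⁺¹∣b′ⁿ⁺¹ : (a / g) ^ suc n ∣ (b / g) ^ suc n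
    a′ⁿ⁺¹∣b′ⁿ⁺¹ = *-cancelʳ-∣ (g ^ suc n) {{m^n≢0 g (suc n)}}
                    (subst₂ _∣_ (split a a≡) (split b (m/n*n≡m (gcd[m,n]∣n a b))) aⁿ⁺¹∣bⁿ⁺¹)
    a′≡1 : a / g ≡ 1
    a′≡1 = coprime-^ʳ (suc n) (coprime-/gcd a b) (∣-refl , ∣-trans (m∣m*n ((a / g) ^ n)) a′ⁿ⁺¹∣b′ⁿ⁺¹)
    g≡a : g ≡ a
    g≡a = trans (sym (*-identityˡ g)) (trans (cong (_* g) (sym a′≡1)) a≡)

  -- With d = gcd a c, a = a′d and c = c′d: then a′b = c′ⁿ⁺¹dⁿ, and coprimality forces a′ = dⁿ.
  coprime-factor-of-power : ∀ {a b c} n .{{_ : NonZero c}} → Coprime a b → a * b ≡ c ^ suc n →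
                            a ≡ gcd a c ^ suc n
  coprime-factor-of-power {a} {b} {c} n a⊥b ab≡cⁿ⁺¹ = begin
    a         ≡⟨ a≡ ⟨
    a′ * d    ≡⟨ cong (_* d) (∣-antisym a′∣dⁿ dⁿ∣a′) ⟩
    d ^ n * d ≡⟨ *-comm (d ^ n) d ⟩
    d ^ suc n ∎
    where
    open ≡-Reasoning
    d = gcd a c
    instance
      d≢0 : NonZero d
      d≢0 = ≢-nonZero (gcd[m,n]≢0 a c (inj₂ (≢-nonZero⁻¹ c)))
    a′ = a / d
    c′ = c / d
    a≡ : a′ * d ≡ a
    a≡ = m/n*n≡m (gcd[m,n]∣m a c)
    c≡ : c′ * d ≡ c
    c≡ = m/n*n≡m (gcd[m,n]∣n a c)
    swap-last : ∀ x y z → x * y * z ≡ x * z * y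
    swap-last = solve-∀
    reassoc : ∀ x y z → x * (y * z) ≡ x * z * y
    reassoc = solve-∀
    a′b≡ : a′ * b ≡ c′ ^ suc n * d ^ n
    a′b≡ = *-cancelʳ-≡ _ _ d (begin
      a′ * b * d                ≡⟨ swap-last a′ b d ⟩
      a′ * d * b                ≡⟨ cong (_* b) a≡ ⟩
      a * b                     ≡⟨ ab≡cⁿ⁺¹ ⟩
      c ^ suc n                 ≡⟨ cong (_^ suc n) c≡ ⟨
      (c′ * d) ^ suc n          ≡⟨ ^-distribʳ-* c′ d (suc n) ⟩
      c′ ^ suc n * (d * d ^ n)  ≡⟨ reassoc (c′ ^ suc n) d (d ^ n) ⟩
      c′ ^ suc n * d ^ n * d    ∎)
    a′∣dⁿ : a′ ∣ d ^ n
    a′∣dⁿ = coprime-divisor (coprime-^ʳ (suc n) (coprime-/gcd a c)) (subst (a′ ∣_) a′b≡ (m∣m*n b))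
    dⁿ⊥b : Coprime (d ^ n) b
    dⁿ⊥b = Coprimality.sym (coprime-^ʳ n (coprime-∣ʳ (Coprimality.sym a⊥b) (gcd[m,n]∣m a c)))
    dⁿ∣a′ : d ^ n ∣ a′
    dⁿ∣a′ = coprime-divisor dⁿ⊥b (subst (d ^ n ∣_) (trans (sym a′b≡) (*-comm a′ b)) (n∣m*n (c′ ^ suc n)))

  FourthPowerSplit : ℕ → ℕ → ℕ → ℕ → Set
  FourthPowerSplit a b g h = (a ≡ g ^ 4 × b ≡ 27 * h ^ 4) ⊎ (a ≡ 27 * h ^ 4 × b ≡ g ^ 4)

  private
    coprime-factors-of-27c⁴-with-3∣ʳ : ∀ {a b c} .{{_ : NonZero c}} → Coprime a b → a * b ≡ 27 * c ^ 4 →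
                                        3 ∣ b → ∃₂ λ g h → c ≡ g * h × a ≡ g ^ 4 × b ≡ 27 * h ^ 4
    coprime-factors-of-27c⁴-with-3∣ʳ {a} {b} {c} a⊥b ab≡27c⁴ 3∣b =
      g , h , c≡gh , a≡g⁴ , trans (_∣_.equality 27∣b) (trans (cong (_* 27) b′≡h⁴) (*-comm (h ^ 4) 27))
      where
      27∣b : 27 ∣ b
      27∣b = coprime-divisor (Coprimality.sym (coprime-^ʳ 3 (coprime-∣ʳ a⊥b 3∣b)))
               (divides (c ^ 4) (trans ab≡27c⁴ (*-comm 27 (c ^ 4))))
      b′ = quotient 27∣b
      b′∣b : b′ ∣ b
      b′∣b = divides 27 (trans (_∣_.equality 27∣b) (*-comm b′ 27))
      reassoc : ∀ x y → x * (y * 27) ≡ x * y * 27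
      reassoc = solve-∀
      ab′≡c⁴ : a * b′ ≡ c ^ 4
      ab′≡c⁴ = *-cancelʳ-≡ _ _ 27
        (trans (sym (reassoc a b′)) (trans (cong (a *_) (sym (_∣_.equality 27∣b))) (trans ab≡27c⁴ (*-comm 27 (c ^ 4)))))
      g = gcd a c
      h = gcd b′ c
      a≡g⁴ : a ≡ g ^ 4
      a≡g⁴ = coprime-factor-of-power 3 (coprime-∣ʳ a⊥b b′∣b) ab′≡c⁴
      b′≡h⁴ : b′ ≡ h ^ 4
      b′≡h⁴ = coprime-factor-of-power 3 (Coprimality.sym (coprime-∣ʳ a⊥b b′∣b)) (trans (*-comm b′ a) ab′≡c⁴)
      c≡gh : c ≡ g * h
      c≡gh = ^-injectiveˡ 3 (trans (sym ab′≡c⁴) (trans (cong₂ _*_ a≡g⁴ b′≡h⁴) (sym (^-distribʳ-* g h 4))))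

  coprime-factors-of-27c⁴ : ∀ {a b c} .{{_ : NonZero c}} → Coprime a b → a * b ≡ 27 * c ^ 4 →
                            ∃₂ λ g h → c ≡ g * h × FourthPowerSplit a b g h
  coprime-factors-of-27c⁴ {a} {b} {c} a⊥b ab≡27c⁴ =
    from-3∣ (euclidsLemma a b prime-3 (subst (3 ∣_) (sym ab≡27c⁴) (∣m⇒∣m*n (c ^ 4) (divides 9 refl))))
    where
    from-3∣ : 3 ∣ a ⊎ 3 ∣ b → ∃₂ λ g h → c ≡ g * h × FourthPowerSplit a b g h
    from-3∣ (inj₁ 3∣a) =
      let g , h , c≡gh , b≡g⁴ , a≡27h⁴ =
            coprime-factors-of-27c⁴-with-3∣ʳ (Coprimality.sym a⊥b) (trans (*-comm b a) ab≡27c⁴) 3∣a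
      in  g , h , c≡gh , inj₂ (a≡27h⁴ , b≡g⁴)
    from-3∣ (inj₂ 3∣b) =
      let g , h , c≡gh , a≡g⁴ , b≡27h⁴ = coprime-factors-of-27c⁴-with-3∣ʳ a⊥b ab≡27c⁴ 3∣b
      in  g , h , c≡gh , inj₁ (a≡g⁴ , b≡27h⁴)

  split-sum : ∀ {a b g h} → FourthPowerSplit a b g h → a + b ≡ g ^ 4 + 27 * h ^ 4
  split-sum (inj₁ (refl , refl)) = refl
  split-sum {g = g} {h} (inj₂ (refl , refl)) = +-comm (27 * h ^ 4) (g ^ 4)

  split-coprime : ∀ {a b g h} → Coprime a b → FourthPowerSplit a b g h → Coprime g (3 * h)
  split-coprime {g = g} {h} a⊥b (inj₁ (refl , refl)) =
    Coprimality.sym (coprime-∣ʳ (Coprimality.sym (coprime-∣ʳ a⊥b (divides (9 * h ^ 3) (regroup h (h ^ 3)))))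
                                (divides (g ^ 3) (*-comm g (g ^ 3))))
    where
    regroup : ∀ h y → 27 * (h * y) ≡ 9 * y * (3 * h)
    regroup = solve-∀
  split-coprime {g = g} {h} a⊥b (inj₂ (refl , refl)) =
    split-coprime {g = g} {h} (Coprimality.sym a⊥b) (inj₁ (refl , refl))

  coprime-3c⇒coprime-27c⁴ : ∀ {a c} → Coprime a (3 * c) → Coprime a (27 * c ^ 4)
  coprime-3c⇒coprime-27c⁴ {a} {c} a⊥3c =
    coprime-∣ʳ (coprime-^ʳ 4 a⊥3c) (divides 3 (trans (^-distribʳ-* 3 c 4) (regroup (c ^ 4))))
    where
    regroup : ∀ x → 81 * x ≡ 3 * (27 * x)
    regroup = solve-∀

module Residues where

  open import Data.Empty using (⊥-elim)
  open import Data.Product using (∃; ∃₂; _,_; _×_)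
  open import Data.Sum using (_⊎_; inj₁; inj₂)
  open import Relation.Binary.PropositionalEquality
  open import Relation.Binary.Definitions using (tri<; tri≈; tri>)
  open import Relation.Nullary using (¬_)
  open import Function using (case_of_)

  open import Data.Nat as ℕ using (ℕ; suc; z≤n; s≤s; NonZero)
  import Data.Nat.Properties as ℕ
  import Data.Nat.Divisibility as ℕ
  open import Data.Integer as ℤ using (ℤ; +_; _+_; _*_; _-_; ∣_∣; _⊖_; _%ℕ_; _/ℕ_)
  import Data.Integer.Properties as ℤ
  open import Data.Integer.DivMod using (n%ℕd<d; a≡a%ℕn+[a/ℕn]*n)
  open import Data.Integer.Divisibility.Signed using (divides; ∣⇒∣ᵤ)
  open import Data.Integer.Tactic.RingSolver using (solve-∀)

  infix 4 _≡_mod_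
  record _≡_mod_ (x : ℤ) (r N : ℕ) : Set where
    constructor _,_
    field
      quotient : ℤ
      equation : x ≡ + N * quotient + + r

  distinct-residues : ∀ {N c d} x y → d ℕ.< c → c ℕ.< N → + N * x + + c ≢ + N * y + + d
  distinct-residues {N} {c} {d} x y d<c c<N eq = ℕ.<⇒≱ (ℕ.≤-<-trans (ℕ.m∸n≤m c d) c<N) (ℕ.∣⇒≤ N∣c∸d)
    where
    open ≡-Reasoning
    instance
      c∸d≢0 : NonZero (c ℕ.∸ d)
      c∸d≢0 = ℕ.>-nonZero (ℕ.m<n⇒0<n∸m d<c)
    shift : ∀ n x a b → a - b ≡ (n * x + a) - (n * x + b)
    shift = solve-∀
    factor : ∀ n x y b → (n * y + b) - (n * x + b) ≡ (y - x) * n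
    factor = solve-∀
    c∸d≡ : + (c ℕ.∸ d) ≡ (y - x) * + N
    c∸d≡ = begin
      + (c ℕ.∸ d)                         ≡⟨ ℤ.⊖-≥ (ℕ.<⇒≤ d<c) ⟨
      c ⊖ d                               ≡⟨ ℤ.m-n≡m⊖n c d ⟨
      + c - + d                           ≡⟨ shift (+ N) x (+ c) (+ d) ⟩
      (+ N * x + + c) - (+ N * x + + d)   ≡⟨ cong (_- (+ N * x + + d)) eq ⟩
      (+ N * y + + d) - (+ N * x + + d)   ≡⟨ factor (+ N) x y (+ d) ⟩
      (y - x) * + N                       ∎
    N∣c∸d : N ℕ.∣ c ℕ.∸ d
    N∣c∸d = ∣⇒∣ᵤ (divides (y - x) c∸d≡)

  residue-unique : ∀ {x N c d} → x ≡ c mod N → x ≡ d mod N → c ℕ.< N → d ℕ.< N → c ≡ d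
  residue-unique {c = c} {d} (q₁ , x≡₁) (q₂ , x≡₂) c<N d<N with ℕ.<-cmp c d
  ... | tri< c<d _ _ = ⊥-elim (distinct-residues q₂ q₁ c<d d<N (trans (sym x≡₂) x≡₁))
  ... | tri≈ _ c≡d _ = c≡d
  ... | tri> _ _ c>d = ⊥-elim (distinct-residues q₁ q₂ c>d c<N (trans (sym x≡₁) x≡₂))

  residue : ∀ x N .{{_ : NonZero N}} → ∃ λ r → r ℕ.< N × x ≡ r mod N
  residue x N = x %ℕ N , n%ℕd<d x N , x /ℕ N , trans (a≡a%ℕn+[a/ℕn]*n x N) (reorder (+ (x %ℕ N)) (x /ℕ N) (+ N))
    where
    reorder : ∀ r q n → r + q * n ≡ n * q + r
    reorder = solve-∀

  ≡0-mod⇒∣ : ∀ {x N} → x ≡ 0 mod N → N ℕ.∣ ∣ x ∣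
  ≡0-mod⇒∣ {N = N} (q , x≡) = ∣⇒∣ᵤ (divides q (trans x≡ (reorder (+ N) q)))
    where
    reorder : ∀ n q → n * q + + 0 ≡ q * n
    reorder = solve-∀

  ∣⇒≡0-mod : ∀ {n N} → N ℕ.∣ n → + n ≡ 0 mod N
  ∣⇒≡0-mod {n} {N} (ℕ.divides q n≡qN) = + q , trans (cong +_ n≡qN) (trans (ℤ.pos-* q N) (reorder (+ q) (+ N)))
    where
    reorder : ∀ q n → q * n ≡ n * q + + 0
    reorder = solve-∀

  even-or-odd : ∀ x → x ≡ 0 mod 2 ⊎ x ≡ 1 mod 2
  even-or-odd x with residue x 2
  ... | 0 , _ , x≡0 = inj₁ x≡0
  ... | 1 , _ , x≡1 = inj₂ x≡1
  ... | suc (suc _) , s≤s (s≤s ()) , _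

  odd⇒¬2∣ : ∀ {n} → + n ≡ 1 mod 2 → ¬ 2 ℕ.∣ n
  odd⇒¬2∣ n-odd 2∣n with residue-unique n-odd (∣⇒≡0-mod 2∣n) (s≤s (s≤s z≤n)) (s≤s z≤n)
  ... | ()

  even-square : ∀ {x} → x ≡ 0 mod 2 → ∃ λ u → x * x ≡ + 4 * (u * u)
  even-square (u , x≡) = u , trans (cong₂ _*_ x≡ x≡) (square u)
    where
    square : ∀ u → (+ 2 * u + + 0) * (+ 2 * u + + 0) ≡ + 4 * (u * u)
    square = solve-∀

  odd-square : ∀ {x} → x ≡ 1 mod 2 → x * x ≡ 1 mod 8
  odd-square (q , refl) with even-or-odd q
  ... | inj₁ (w , refl) = + 2 * w * w + w , square w
    where
    square : ∀ w → (+ 2 * (+ 2 * w + + 0) + + 1) * (+ 2 * (+ 2 * w + + 0) + + 1) ≡ + 8 * (+ 2 * w * w + w) + + 1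
    square = solve-∀
  ... | inj₂ (w , refl) = + 2 * w * w + + 3 * w + + 1 , square w
    where
    square : ∀ w → (+ 2 * (+ 2 * w + + 1) + + 1) * (+ 2 * (+ 2 * w + + 1) + + 1) ≡ + 8 * (+ 2 * w * w + + 3 * w + + 1) + + 1
    square = solve-∀

  even⇒¬square-odd : ∀ {x} → x ≡ 0 mod 2 → ¬ (x * x ≡ 1 mod 2)
  even⇒¬square-odd x-even x²-odd =
    let u , x²≡4u² = even-square x-even
    in  0≢1 (residue-unique (u * u * + 2 , trans x²≡4u² (regroup u)) x²-odd (s≤s z≤n) (s≤s (s≤s z≤n)))
    where
    regroup : ∀ u → + 4 * (u * u) ≡ + 2 * (u * u * + 2) + + 0
    regroup = solve-∀
    0≢1 : 0 ≢ 1
    0≢1 ()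

  square-mod-3 : ∀ x → x ≡ 0 mod 3 ⊎ x * x ≡ 1 mod 3
  square-mod-3 x with residue x 3
  ... | 0 , _ , x≡0 = inj₁ x≡0
  ... | 1 , _ , q , refl = inj₂ (+ 3 * q * q + + 2 * q , square q)
    where
    square : ∀ q → (+ 3 * q + + 1) * (+ 3 * q + + 1) ≡ + 3 * (+ 3 * q * q + + 2 * q) + + 1
    square = solve-∀
  ... | 2 , _ , q , refl = inj₂ (+ 3 * q * q + + 4 * q + + 1 , square q)
    where
    square : ∀ q → (+ 3 * q + + 2) * (+ 3 * q + + 2) ≡ + 3 * (+ 3 * q * q + + 4 * q + + 1) + + 1
    square = solve-∀
  ... | suc (suc (suc _)) , s≤s (s≤s (s≤s ())) , _

  square-residue-mod-4 : ∀ x {r} → r ℕ.< 4 → x * x ≡ r mod 4 → r ≡ 0 ⊎ r ≡ 1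
  square-residue-mod-4 x r<4 x²≡r with even-or-odd x
  ... | inj₁ x-even =
    let u , x²≡4u² = even-square x-even
    in  inj₁ (residue-unique x²≡r (u * u , trans x²≡4u² (sym (ℤ.+-identityʳ _))) r<4 (s≤s z≤n))
  ... | inj₂ x-odd =
    let z , x²≡8z+1 = odd-square x-odd
    in  inj₂ (residue-unique x²≡r (+ 2 * z , trans x²≡8z+1 (regroup z)) r<4 (s≤s (s≤s z≤n)))
    where
    regroup : ∀ z → + 8 * z + + 1 ≡ + 4 * (+ 2 * z) + + 1
    regroup = solve-∀

  square-residue-mod-8 : ∀ x {r} → r ℕ.< 8 → x * x ≡ r mod 8 → r ≡ 0 ⊎ r ≡ 1 ⊎ r ≡ 4
  square-residue-mod-8 x r<8 x²≡r with even-or-odd x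
  ... | inj₂ x-odd = inj₂ (inj₁ (residue-unique x²≡r (odd-square x-odd) r<8 (s≤s (s≤s z≤n))))
  ... | inj₁ (u , refl) with even-or-odd u
  ...   | inj₁ (w , refl) = inj₁ (residue-unique x²≡r (w * w * + 2 , square w) r<8 (s≤s z≤n))
    where
    square : ∀ w → (+ 2 * (+ 2 * w + + 0) + + 0) * (+ 2 * (+ 2 * w + + 0) + + 0) ≡ + 8 * (w * w * + 2) + + 0
    square = solve-∀
  ...   | inj₂ (w , refl) = inj₂ (inj₂ (residue-unique x²≡r (+ 2 * w * w + + 2 * w , square w) r<8 (s≤s (s≤s (s≤s (s≤s (s≤s z≤n)))))))
    where
    square : ∀ w → (+ 2 * (+ 2 * w + + 1) + + 0) * (+ 2 * (+ 2 * w + + 1) + + 0) ≡ + 8 * (+ 2 * w * w + + 2 * w) + + 4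
    square = solve-∀

  square≢16q+8 : ∀ x q → x * x ≢ + 16 * q + + 8
  square≢16q+8 x q x²≡ with even-or-odd x
  ... | inj₂ x-odd =
    case residue-unique (odd-square x-odd) (+ 2 * q + + 1 , trans x²≡ (regroup q)) (s≤s (s≤s z≤n)) (s≤s z≤n) of λ ()
    where
    regroup : ∀ q → + 16 * q + + 8 ≡ + 8 * (+ 2 * q + + 1) + + 0
    regroup = solve-∀
  ... | inj₁ x-even =
    let u , x²≡4u² = even-square x-even
        u²≡ = ℤ.*-cancelˡ-≡ (+ 4) (u * u) (+ 4 * q + + 2) (trans (sym x²≡4u²) (trans x²≡ (regroup q)))
    in  case square-residue-mod-4 u (s≤s (s≤s (s≤s z≤n))) (q , u²≡) of λ { (inj₁ ()) ; (inj₂ ()) }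
    where
    regroup : ∀ q → + 16 * q + + 8 ≡ + 4 * (+ 4 * q + + 2)
    regroup = solve-∀

  square-plus-fourth-power-mod-3 : ∀ X Y → ¬ (Y ≡ 0 mod 3) → ¬ (X * X + Y * Y * (Y * Y) ≡ 0 mod 3)
  square-plus-fourth-power-mod-3 X Y 3∤Y sum≡0 with square-mod-3 Y | square-mod-3 X
  ... | inj₁ Y≡0       | _ = 3∤Y Y≡0
  ... | inj₂ (q , Y²≡) | inj₁ (p , refl) =
    case residue-unique sum≡0 (+ 3 * p * p + + 3 * q * q + + 2 * q , trans (cong (λ v → (+ 3 * p + + 0) * (+ 3 * p + + 0) + v * v) Y²≡) (reduce p q))
                        (s≤s z≤n) (s≤s (s≤s z≤n)) of λ ()
    where
    reduce : ∀ p q → (+ 3 * p + + 0) * (+ 3 * p + + 0) + (+ 3 * q + + 1) * (+ 3 * q + + 1) ≡ + 3 * (+ 3 * p * p + + 3 * q * q + + 2 * q) + + 1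
    reduce = solve-∀
  ... | inj₂ (q , Y²≡) | inj₂ (p , X²≡) =
    case residue-unique sum≡0 (p + + 3 * q * q + + 2 * q , trans (cong₂ (λ u v → u + v * v) X²≡ Y²≡) (reduce p q))
                        (s≤s z≤n) (s≤s (s≤s (s≤s z≤n))) of λ ()
    where
    reduce : ∀ p q → (+ 3 * p + + 1) + (+ 3 * q + + 1) * (+ 3 * q + + 1) ≡ + 3 * (p + + 3 * q * q + + 2 * q) + + 2
    reduce = solve-∀

  halve-difference-of-odd-squares : ∀ {U V D} → U ≡ 1 mod 2 → V ≡ 1 mod 2 → U * U - V * V ≡ + 4 * D →
                                    ∃₂ λ A B → A * B ≡ D × A + B ≡ U × B - A ≡ V
  halve-difference-of-odd-squares {U} {V} {D} (ρ , U≡) (s , V≡) U²-V²≡4D =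
    ρ - s , ρ + s + + 1 , AB≡D , trans (sum ρ s) (sym U≡) , trans (difference ρ s) (sym V≡)
    where
    factor : ∀ ρ s → + 4 * ((ρ - s) * (ρ + s + + 1)) ≡ (+ 2 * ρ + + 1) * (+ 2 * ρ + + 1) - (+ 2 * s + + 1) * (+ 2 * s + + 1)
    factor = solve-∀
    sum : ∀ ρ s → (ρ - s) + (ρ + s + + 1) ≡ + 2 * ρ + + 1
    sum = solve-∀
    difference : ∀ ρ s → (ρ + s + + 1) - (ρ - s) ≡ + 2 * s + + 1
    difference = solve-∀
    AB≡D : (ρ - s) * (ρ + s + + 1) ≡ D
    AB≡D = ℤ.*-cancelˡ-≡ (+ 4) _ _ (trans (factor ρ s) (trans (cong₂ (λ u v → u * u - v * v) (sym U≡) (sym V≡)) U²-V²≡4D))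

module IntegerFactorisation where

  open import Data.Empty using (⊥-elim)
  open import Data.Product using (∃; _,_; _×_)
  open import Data.Sum using (_⊎_; inj₁; inj₂)
  open import Relation.Binary.PropositionalEquality

  open import Data.Nat as ℕ using (ℕ; zero; suc; NonZero)
  import Data.Nat.Properties as ℕ
  import Data.Nat.Divisibility as ℕ
  open import Data.Nat.Coprimality using (Coprime)
  open import Data.Nat.Primality using (euclidsLemma)
  import Data.Nat.Tactic.RingSolver as ℕ-Solver
  open import Data.Integer as ℤ using (ℤ; +_; -[1+_]; _+_; _*_; -_; ∣_∣; 0ℤ)
  import Data.Integer.Properties as ℤ
  open import Data.Integer.Divisibility.Signed using (_∣_; divides; ∣-trans; *-cancelˡ-∣; ∣⇒∣ᵤ; ∣ᵤ⇒∣; ∣m⇒∣m*n; ∣n⇒∣m*n; ∣m+n∣n⇒∣m)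
  open import Data.Integer.Tactic.RingSolver using (solve-∀)

  open CoprimeFactorisation

  abs-square : ∀ x → + ∣ x ∣ * + ∣ x ∣ ≡ x * x
  abs-square x with ℤ.+∣i∣≡i⊎+∣i∣≡-i x
  ... | inj₁ ∣x∣≡x  = cong₂ _*_ ∣x∣≡x ∣x∣≡x
  ... | inj₂ ∣x∣≡-x = trans (cong₂ _*_ ∣x∣≡-x ∣x∣≡-x) (neg-square x)
    where
    neg-square : ∀ x → - x * - x ≡ x * x
    neg-square = solve-∀

  ^4-unfold : ∀ n → n ℕ.^ 4 ≡ n ℕ.* n ℕ.* (n ℕ.* n)
  ^4-unfold = unfolded
    where
    unfolded : ∀ n → n ℕ.* (n ℕ.* (n ℕ.* (n ℕ.* 1))) ≡ n ℕ.* n ℕ.* (n ℕ.* n)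
    unfolded = ℕ-Solver.solve-∀

  abs-fourth-power : ∀ x → ∣ x * x * (x * x) ∣ ≡ ∣ x ∣ ℕ.^ 4
  abs-fourth-power x = begin
    ∣ x * x * (x * x) ∣                   ≡⟨ ℤ.abs-* (x * x) (x * x) ⟩
    ∣ x * x ∣ ℕ.* ∣ x * x ∣               ≡⟨ cong₂ ℕ._*_ (ℤ.abs-* x x) (ℤ.abs-* x x) ⟩
    ∣ x ∣ ℕ.* ∣ x ∣ ℕ.* (∣ x ∣ ℕ.* ∣ x ∣) ≡⟨ ^4-unfold ∣ x ∣ ⟨
    ∣ x ∣ ℕ.^ 4                           ∎
    where open ≡-Reasoning

  pos-^4 : ∀ n → + (n ℕ.^ 4) ≡ + n * + n * (+ n * + n)
  pos-^4 n = begin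
    + (n ℕ.^ 4)                ≡⟨ cong +_ (^4-unfold n) ⟩
    + (n ℕ.* n ℕ.* (n ℕ.* n))  ≡⟨ ℤ.pos-* (n ℕ.* n) (n ℕ.* n) ⟩
    + (n ℕ.* n) * + (n ℕ.* n)  ≡⟨ cong₂ _*_ (ℤ.pos-* n n) (ℤ.pos-* n n) ⟩
    + n * + n * (+ n * + n)    ∎
    where open ≡-Reasoning

  27c⁴-as-natural : ∀ c → + 27 * (c * c * (c * c)) ≡ + (27 ℕ.* ∣ c ∣ ℕ.^ 4)
  27c⁴-as-natural c = begin
    + 27 * (c * c * (c * c))                          ≡⟨ cong (λ x → + 27 * (x * x)) (abs-square c) ⟨
    + 27 * (+ ∣ c ∣ * + ∣ c ∣ * (+ ∣ c ∣ * + ∣ c ∣))  ≡⟨ cong (+ 27 *_) (pos-^4 ∣ c ∣) ⟨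
    + 27 * + (∣ c ∣ ℕ.^ 4)                            ≡⟨ ℤ.pos-* 27 (∣ c ∣ ℕ.^ 4) ⟨
    + (27 ℕ.* ∣ c ∣ ℕ.^ 4)                            ∎
    where open ≡-Reasoning

  both-nonneg : ∀ {A B} → 0ℤ ℤ.< A * B → 0ℤ ℤ.≤ A + B → A ≡ + ∣ A ∣ × B ≡ + ∣ B ∣
  both-nonneg {+ _}      {+ _}      _    _  = refl , refl
  both-nonneg {+ zero}   { -[1+ _ ]} (ℤ.+<+ ()) _
  both-nonneg {+ suc _}  { -[1+ _ ]} ()   _
  both-nonneg { -[1+ a ]} {+ zero}   0<AB _  = ⊥-elim (ℤ.<-irrefl (sym (ℤ.*-zeroʳ -[1+ a ])) 0<AB)
  both-nonneg { -[1+ _ ]} {+ suc _}  ()   _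
  both-nonneg { -[1+ _ ]} { -[1+ _ ]} _    ()

  3∣square⇒3∣ : ∀ x → + 3 ∣ x * x → + 3 ∣ x
  3∣square⇒3∣ x 3∣x² with euclidsLemma ∣ x ∣ ∣ x ∣ prime-3 (subst (3 ℕ.∣_) (ℤ.abs-* x x) (∣⇒∣ᵤ 3∣x²))
  ... | inj₁ 3∣∣x∣ = ∣ᵤ⇒∣ 3∣∣x∣
  ... | inj₂ 3∣∣x∣ = ∣ᵤ⇒∣ 3∣∣x∣

  3∣square⇒9∣square : ∀ x → + 3 ∣ x * x → ∃ λ y → x * x ≡ + 9 * (y * y)
  3∣square⇒9∣square x 3∣x² =
    let divides y x≡y3 = 3∣square⇒3∣ x 3∣x²
    in  y , trans (cong₂ _*_ x≡y3 x≡y3) (square y)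
    where
    square : ∀ y → y * + 3 * (y * + 3) ≡ + 9 * (y * y)
    square = solve-∀

  27∣square⇒81∣square : ∀ x → + 27 ∣ x * x → + 81 ∣ x * x
  27∣square⇒81∣square x 27∣x² =
    let y , x²≡9y² = 3∣square⇒9∣square x (∣-trans 3∣27 27∣x²)
        w , y²≡9w² = 3∣square⇒9∣square y (*-cancelˡ-∣ (+ 9) {+ 3} (subst (+ 27 ∣_) x²≡9y² 27∣x²))
    in  divides (w * w) (trans x²≡9y² (trans (cong (+ 9 *_) y²≡9w²) (regroup (w * w))))
    where
    3∣27 : + 3 ∣ + 27
    3∣27 = divides (+ 9) refl
    regroup : ∀ z → + 9 * (+ 9 * z) ≡ z * + 81
    regroup = solve-∀

  coprime-+-* : ∀ x y z → Coprime ∣ x ∣ ∣ z ∣ → Coprime ∣ x + y * z ∣ ∣ z ∣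
  coprime-+-* x y z x⊥z {d} (d∣x+yz , d∣z) =
    x⊥z (∣⇒∣ᵤ (∣m+n∣n⇒∣m {+ d} {x} (∣ᵤ⇒∣ d∣x+yz) (∣n⇒∣m*n y (∣ᵤ⇒∣ {+ d} {z} d∣z))) , d∣z)

  coprime-*ˡ-abs : ∀ x y {c} → Coprime ∣ x ∣ c → Coprime ∣ y ∣ c → Coprime ∣ x * y ∣ c
  coprime-*ˡ-abs x y x⊥c y⊥c = subst (λ n → Coprime n _) (sym (ℤ.abs-* x y)) (coprime-*ˡ x⊥c y⊥c)

  coprime-via-combination : ∀ {L A B c : ℤ} x y → (∀ {d} → d ∣ A → d ∣ B → d ∣ L) → L ≡ x + y * (+ 3 * c) →
                            Coprime ∣ x ∣ (3 ℕ.* ∣ c ∣) → A * B ≡ + 27 * (c * c * (c * c)) → Coprime ∣ A ∣ ∣ B ∣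
  coprime-via-combination {L} {A} {B} {c} x y combination L≡ x⊥3c AB≡27c⁴ {d} (d∣∣A∣ , d∣∣B∣) =
    coprime-3c⇒coprime-27c⁴ {∣ L ∣} {∣ c ∣} L⊥3c (d∣∣L∣ , d∣27c⁴)
    where
    ∣3c∣≡ : ∣ + 3 * c ∣ ≡ 3 ℕ.* ∣ c ∣
    ∣3c∣≡ = ℤ.abs-* (+ 3) c
    L⊥3c : Coprime ∣ L ∣ (3 ℕ.* ∣ c ∣)
    L⊥3c = subst₂ (λ z n → Coprime ∣ z ∣ n) (sym L≡) ∣3c∣≡
             (coprime-+-* x y (+ 3 * c) (subst (Coprime ∣ x ∣) (sym ∣3c∣≡) x⊥3c))
    d∣A : + d ∣ A
    d∣A = ∣ᵤ⇒∣ d∣∣A∣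
    d∣∣L∣ : d ℕ.∣ ∣ L ∣
    d∣∣L∣ = ∣⇒∣ᵤ (combination d∣A (∣ᵤ⇒∣ d∣∣B∣))
    d∣27c⁴ : d ℕ.∣ 27 ℕ.* ∣ c ∣ ℕ.^ 4
    d∣27c⁴ = subst (d ℕ.∣_) (cong ∣_∣ (trans AB≡27c⁴ (27c⁴-as-natural c))) (∣⇒∣ᵤ (∣m⇒∣m*n B d∣A))

  FourthPowerSplitℤ : ℤ → ℤ → ℕ → ℕ → Set
  FourthPowerSplitℤ A B g h =
    (A ≡ + g * + g * (+ g * + g) × B ≡ + 27 * (+ h * + h * (+ h * + h))) ⊎
    (A ≡ + 27 * (+ h * + h * (+ h * + h)) × B ≡ + g * + g * (+ g * + g))

  split-sumℤ : ∀ {A B g h} → FourthPowerSplitℤ A B g h → A + B ≡ + g * + g * (+ g * + g) + + 27 * (+ h * + h * (+ h * + h))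
  split-sumℤ (inj₁ (refl , refl)) = refl
  split-sumℤ {g = g} {h} (inj₂ (refl , refl)) = ℤ.+-comm (+ 27 * (+ h * + h * (+ h * + h))) (+ g * + g * (+ g * + g))

  record Factorisation (A B c : ℤ) : Set where
    field
      g h    : ℕ
      h≢0    : h ≢ 0
      c²≡    : c * c ≡ + g * + h * (+ g * + h)
      g⊥3h   : Coprime g (3 ℕ.* h)
      ∣A+B∣≡ : ∣ A + B ∣ ≡ g ℕ.^ 4 ℕ.+ 27 ℕ.* h ℕ.^ 4
      splits : FourthPowerSplitℤ A B g h

  factors-of-27c⁴ : ∀ {A B c : ℤ} → c ≢ 0ℤ → Coprime ∣ A ∣ ∣ B ∣ → 0ℤ ℤ.≤ A + B → A * B ≡ + 27 * (c * c * (c * c)) →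
                    Factorisation A B c
  factors-of-27c⁴ {A} {B} {c} c≢0 A⊥B 0≤A+B AB≡27c⁴ =
    let A≡ , B≡ = both-nonneg (subst (0ℤ ℤ.<_) (sym AB≡) (ℤ.+<+ (ℕ.>-nonZero⁻¹ _))) 0≤A+B
        g , h , ∣c∣≡gh , splits = coprime-factors-of-27c⁴ A⊥B ∣A∣∣B∣≡
    in  record
        { g = g ; h = h ; h≢0 = h≢0 g h ∣c∣≡gh ; c²≡ = c²≡ g h ∣c∣≡gh
        ; g⊥3h = split-coprime {g = g} {h} A⊥B splits
        ; ∣A+B∣≡ = trans (cong ∣_∣ (trans (cong₂ _+_ A≡ B≡) (sym (ℤ.pos-+ ∣ A ∣ ∣ B ∣)))) (split-sum {g = g} {h} splits)
        ; splits = lift {g} {h} A≡ B≡ splits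
        }
    where
    instance
      ∣c∣≢0 : NonZero ∣ c ∣
      ∣c∣≢0 = ℕ.≢-nonZero (λ ∣c∣≡0 → c≢0 (ℤ.∣i∣≡0⇒i≡0 ∣c∣≡0))
      27c⁴≢0 : NonZero (27 ℕ.* ∣ c ∣ ℕ.^ 4)
      27c⁴≢0 = ℕ.m*n≢0 27 (∣ c ∣ ℕ.^ 4) {{_}} {{ℕ.m^n≢0 ∣ c ∣ 4}}
    AB≡ : A * B ≡ + (27 ℕ.* ∣ c ∣ ℕ.^ 4)
    AB≡ = trans AB≡27c⁴ (27c⁴-as-natural c)
    h≢0 : ∀ g h → ∣ c ∣ ≡ g ℕ.* h → h ≢ 0
    h≢0 g h ∣c∣≡gh h≡0 = c≢0 (ℤ.∣i∣≡0⇒i≡0 (trans ∣c∣≡gh (trans (cong (g ℕ.*_) h≡0) (ℕ.*-zeroʳ g))))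
    c²≡ : ∀ g h → ∣ c ∣ ≡ g ℕ.* h → c * c ≡ + g * + h * (+ g * + h)
    c²≡ g h ∣c∣≡gh = trans (sym (abs-square c)) (trans (cong (λ n → + n * + n) ∣c∣≡gh) (cong₂ _*_ (ℤ.pos-* g h) (ℤ.pos-* g h)))
    ∣A∣∣B∣≡ : ∣ A ∣ ℕ.* ∣ B ∣ ≡ 27 ℕ.* ∣ c ∣ ℕ.^ 4
    ∣A∣∣B∣≡ = trans (sym (ℤ.abs-* A B)) (cong ∣_∣ AB≡)
    g⁴ : ∀ {X g} → X ≡ + ∣ X ∣ → ∣ X ∣ ≡ g ℕ.^ 4 → X ≡ + g * + g * (+ g * + g)
    g⁴ {X} {g} X≡ ∣X∣≡ = trans X≡ (trans (cong +_ ∣X∣≡) (pos-^4 g))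
    27h⁴ : ∀ {X h} → X ≡ + ∣ X ∣ → ∣ X ∣ ≡ 27 ℕ.* h ℕ.^ 4 → X ≡ + 27 * (+ h * + h * (+ h * + h))
    27h⁴ {X} {h} X≡ ∣X∣≡ = trans X≡ (trans (cong +_ ∣X∣≡) (trans (ℤ.pos-* 27 (h ℕ.^ 4)) (cong (+ 27 *_) (pos-^4 h))))
    lift : ∀ {g h} → A ≡ + ∣ A ∣ → B ≡ + ∣ B ∣ → FourthPowerSplit ∣ A ∣ ∣ B ∣ g h → FourthPowerSplitℤ A B g h
    lift {g} {h} A≡ B≡ (inj₁ (∣A∣≡ , ∣B∣≡)) = inj₁ (g⁴ {g = g} A≡ ∣A∣≡ , 27h⁴ {h = h} B≡ ∣B∣≡)
    lift {g} {h} A≡ B≡ (inj₂ (∣A∣≡ , ∣B∣≡)) = inj₂ (27h⁴ {h = h} A≡ ∣A∣≡ , g⁴ {g = g} B≡ ∣B∣≡)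

  square-over-fourth-power : ∀ {R Y} d .{{_ : NonZero d}} → + R * + R ≡ Y * (+ d * + d * (+ d * + d)) →
                             ∃ λ R′ → + R′ * + R′ ≡ Y
  square-over-fourth-power {R} {Y} d R²≡YD⁴ = R′ , ℤ.*-cancelʳ-≡ _ _ D⁴ (begin
    + R′ * + R′ * D⁴                    ≡⟨ regroup (+ R′) D ⟩
    (+ R′ * (D * D)) * (+ R′ * (D * D)) ≡⟨ cong₂ _*_ R≡R′D² R≡R′D² ⟨
    + R * + R                           ≡⟨ R²≡YD⁴ ⟩
    Y * D⁴                              ∎)
    where
    open ≡-Reasoning
    D = + d
    D⁴ = D * D * (D * D)
    instance
      D⁴≢0 : ℤ.NonZero D⁴
      D⁴≢0 = ℤ.i*j≢0 (D * D) (D * D) {{ℤ.i*j≢0 D D}} {{ℤ.i*j≢0 D D}}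
    square-of-square : ∀ d → (d ℕ.* d) ℕ.^ 2 ≡ d ℕ.^ 4
    square-of-square = unfolded
      where
      unfolded : ∀ d → d ℕ.* d ℕ.* (d ℕ.* d ℕ.* 1) ≡ d ℕ.* (d ℕ.* (d ℕ.* (d ℕ.* 1)))
      unfolded = ℕ-Solver.solve-∀
    square : ∀ R → R ℕ.^ 2 ≡ R ℕ.* R
    square R = cong (R ℕ.*_) (ℕ.*-identityʳ R)
    d²∣R : d ℕ.* d ℕ.∣ R
    d²∣R = ^-cancel-∣ 1 (subst₂ ℕ._∣_ (sym (square-of-square d)) (sym (square R))
             (subst₂ ℕ._∣_ (abs-fourth-power D) (ℤ.abs-* (+ R) (+ R)) (∣⇒∣ᵤ (divides Y R²≡YD⁴))))
    R′ = ℕ.quotient d²∣R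
    R≡R′D² : + R ≡ + R′ * (D * D)
    R≡R′D² = trans (cong +_ (ℕ._∣_.equality d²∣R)) (trans (ℤ.pos-* R′ (d ℕ.* d)) (cong (+ R′ *_) (ℤ.pos-* d d)))
    regroup : ∀ r d → r * r * (d * d * (d * d)) ≡ (r * (d * d)) * (r * (d * d))
    regroup = solve-∀

module Quartics where

  open import Data.Empty using (⊥; ⊥-elim)
  open import Data.Product using (∃; ∃₂; _,_; _×_; proj₂)
  open import Data.Sum using (_⊎_; inj₁; inj₂; [_,_]′)
  open import Relation.Binary.PropositionalEquality
  open import Relation.Nullary using (¬_)
  open import Function using (case_of_)

  open import Data.Nat as ℕ using (ℕ; suc; z≤n; s≤s; NonZero)
  import Data.Nat.Properties as ℕ
  import Data.Nat.Divisibility as ℕ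
  open import Data.Nat.Induction using (<-rec)
  open import Data.Nat.DivMod using (m/n*n≡m)
  open import Data.Nat.GCD using (gcd; gcd[m,n]∣m; gcd[m,n]∣n; gcd[m,n]≢0)
  open import Data.Nat.Coprimality as Coprimality using (Coprime; coprime-/gcd)
  open import Data.Nat.Primality using (prime[2])
  open import Data.Integer as ℤ using (ℤ; +_; _+_; _*_; _-_; -_; ∣_∣; 0ℤ)
  import Data.Integer.Properties as ℤ
  open import Data.Integer.Divisibility.Signed
    using (_∣_; divides; ∣-refl; ∣⇒∣ᵤ; *-cancelˡ-∣; ∣m∣n⇒∣m-n; ∣m∣n⇒∣m+n; ∣m⇒∣m*n)
  open import Data.Integer.Tactic.RingSolver using (solve-∀)

  open CoprimeFactorisation
  open Residues
  open IntegerFactorisation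

  F : ℤ → ℤ → ℤ
  F m k = m * m * (m * m) - + 9 * (m * m) * (k * k) + + 27 * (k * k * (k * k))

  G : ℤ → ℤ → ℤ
  G g h = g * g * (g * g) + + 18 * (g * g) * (h * h) - + 27 * (h * h * (h * h))

  F-in-squares : ∀ m k {u v} → m * m ≡ u → k * k ≡ v → F m k ≡ u * u - + 9 * u * v + + 27 * (v * v)
  F-in-squares m k refl refl = refl

  G-in-squares : ∀ g h {u v} → g * g ≡ u → h * h ≡ v → G g h ≡ u * u + + 18 * u * v - + 27 * (v * v)
  G-in-squares g h refl refl = refl

  -- 3 ∣ m would give v₃(F m k) = 3, which is odd.
  F-square⇒coprime-3 : ∀ {R m k} → Coprime m k → + R * + R ≡ F (+ m) (+ k) → Coprime m 3
  F-square⇒coprime-3 {R} {m} {k} m⊥k R²≡F = ¬∣⇒coprime prime-3 3∤m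
    where
    3∤m : ¬ 3 ℕ.∣ m
    3∤m 3∣m = 3≢1 (m⊥k (3∣m , ∣⇒∣ᵤ {+ 3} {K} (3∣square⇒3∣ K (3∣square⇒3∣ (K * K) 3∣K⁴))))
      where
      open ≡-Reasoning
      3≢1 : 3 ≢ 1
      3≢1 ()
      K = + k
      μ = + ℕ.quotient 3∣m
      m≡3μ : + m ≡ + 3 * μ
      m≡3μ = trans (cong +_ (ℕ._∣_.equality 3∣m)) (trans (ℤ.pos-* (ℕ.quotient 3∣m) 3) (ℤ.*-comm μ (+ 3)))
      Z = + 3 * (μ * μ * (μ * μ)) - + 3 * (μ * μ) * (K * K) + K * K * (K * K)
      R²≡27Z : + R * + R ≡ + 27 * Z
      R²≡27Z = begin
        + R * + R        ≡⟨ R²≡F ⟩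
        F (+ m) K        ≡⟨ cong (λ x → F x K) m≡3μ ⟩
        F (+ 3 * μ) K    ≡⟨ expand μ K ⟩
        + 27 * Z         ∎
        where
        expand : ∀ μ k → (+ 3 * μ) * (+ 3 * μ) * ((+ 3 * μ) * (+ 3 * μ)) - + 9 * ((+ 3 * μ) * (+ 3 * μ)) * (k * k)
                           + + 27 * (k * k * (k * k))
                         ≡ + 27 * (+ 3 * (μ * μ * (μ * μ)) - + 3 * (μ * μ) * (k * k) + k * k * (k * k))
        expand = solve-∀
      3∣Z : + 3 ∣ Z
      3∣Z = *-cancelˡ-∣ (+ 27) {+ 3}
              (subst (+ 81 ∣_) R²≡27Z (27∣square⇒81∣square (+ R) (divides Z (trans R²≡27Z (ℤ.*-comm (+ 27) Z)))))
      3∣K⁴ : + 3 ∣ K * K * (K * K)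
      3∣K⁴ = subst (+ 3 ∣_) (isolate μ K) (∣m∣n⇒∣m-n 3∣Z (∣m⇒∣m*n (μ * μ * (μ * μ) - μ * μ * (K * K)) ∣-refl))
        where
        isolate : ∀ μ k → (+ 3 * (μ * μ * (μ * μ)) - + 3 * (μ * μ) * (k * k) + k * k * (k * k))
                            - + 3 * (μ * μ * (μ * μ) - μ * μ * (k * k))
                          ≡ k * k * (k * k)
        isolate = solve-∀

  four-F≡square+27k⁴ : ∀ m k → + 4 * F m k ≡ (+ 2 * (m * m) - + 9 * (k * k)) * (+ 2 * (m * m) - + 9 * (k * k)) + + 27 * (k * k * (k * k))
  four-F≡square+27k⁴ = expanded
    where
    expanded : ∀ m k → + 4 * (m * m * (m * m) - + 9 * (m * m) * (k * k) + + 27 * (k * k * (k * k)))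
                       ≡ (+ 2 * (m * m) - + 9 * (k * k)) * (+ 2 * (m * m) - + 9 * (k * k)) + + 27 * (k * k * (k * k))
    expanded = solve-∀

  F-homogeneous : ∀ m k d → F (m * d) (k * d) ≡ F m k * (d * d * (d * d))
  F-homogeneous = expanded
    where
    expanded : ∀ m k d → (m * d) * (m * d) * ((m * d) * (m * d)) - + 9 * ((m * d) * (m * d)) * ((k * d) * (k * d))
                           + + 27 * ((k * d) * (k * d) * ((k * d) * (k * d)))
                         ≡ (m * m * (m * m) - + 9 * (m * m) * (k * k) + + 27 * (k * k * (k * k))) * (d * d * (d * d))
    expanded = solve-∀

  G+108h⁴≡square : ∀ g h → G g h + + 4 * (+ 27 * (h * h * (h * h))) ≡ (g * g + + 9 * (h * h)) * (g * g + + 9 * (h * h))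
  G+108h⁴≡square = expanded
    where
    expanded : ∀ g h → g * g * (g * g) + + 18 * (g * g) * (h * h) - + 27 * (h * h * (h * h)) + + 4 * (+ 27 * (h * h * (h * h)))
                       ≡ (g * g + + 9 * (h * h)) * (g * g + + 9 * (h * h))
    expanded = solve-∀

  coprime⇒¬both-even : ∀ {m k} → Coprime m k → + m ≡ 0 mod 2 → + k ≡ 0 mod 2 → ⊥
  coprime⇒¬both-even m⊥k m-even k-even = 2≢1 (m⊥k (≡0-mod⇒∣ m-even , ≡0-mod⇒∣ k-even))
    where
    2≢1 : 2 ≢ 1
    2≢1 ()

  coprime-2-3 : Coprime 2 3
  coprime-2-3 = ¬∣⇒coprime prime-3 (ℕ.>⇒∤ (s≤s (s≤s (s≤s z≤n))))

  F-square⇒odd : ∀ {R m k} → Coprime m k → + R * + R ≡ F (+ m) (+ k) → + m ≡ 1 mod 2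
  F-square⇒odd {R} {m} {k} m⊥k R²≡F = from-parities (even-or-odd (+ m)) (even-or-odd (+ k))
    where
    from-parities : + m ≡ 0 mod 2 ⊎ + m ≡ 1 mod 2 → + k ≡ 0 mod 2 ⊎ + k ≡ 1 mod 2 → + m ≡ 1 mod 2
    from-parities (inj₂ m-odd)  _            = m-odd
    from-parities (inj₁ m-even) (inj₁ k-even) = ⊥-elim (coprime⇒¬both-even m⊥k m-even k-even)
    from-parities (inj₁ m-even) (inj₂ k-odd)  =
      let x , m²≡4x² = even-square m-even
          z , k²≡8z+1 = odd-square k-odd
      in  case square-residue-mod-4 (+ R) (s≤s (s≤s (s≤s (s≤s z≤n))))
                 (W x z , trans R²≡F (trans (F-in-squares (+ m) (+ k) m²≡4x² k²≡8z+1) (reduce x z))) of λ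
            { (inj₁ ()) ; (inj₂ ()) }
      where
      W : ℤ → ℤ → ℤ
      W x z = + 4 * (x * x * (x * x)) - + 9 * (x * x) * (+ 8 * z + + 1) + + 27 * (+ 16 * z * z + + 4 * z) + + 6
      reduce : ∀ x z → + 4 * (x * x) * (+ 4 * (x * x)) - + 9 * (+ 4 * (x * x)) * (+ 8 * z + + 1)
                         + + 27 * ((+ 8 * z + + 1) * (+ 8 * z + + 1))
                       ≡ + 4 * (+ 4 * (x * x * (x * x)) - + 9 * (x * x) * (+ 8 * z + + 1) + + 27 * (+ 16 * z * z + + 4 * z) + + 6) + + 3
      reduce = solve-∀

  27h⁴-g⁴≢X²-18g²h² : ∀ X g h → ¬ (g ≡ 0 mod 3) →
                      + 27 * (h * h * (h * h)) - g * g * (g * g) ≢ X * X - + 18 * (g * h * (g * h))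
  27h⁴-g⁴≢X²-18g²h² X g h 3∤g eq = square-plus-fourth-power-mod-3 X g 3∤g
    (+ 9 * (h * h * (h * h)) + + 6 * (g * g) * (h * h) , (begin
      X * X + g * g * (g * g)
        ≡⟨ split-off X g h ⟩
      (X * X - + 18 * (g * h * (g * h))) + + 18 * (g * h * (g * h)) + g * g * (g * g)
        ≡⟨ cong (λ y → y + + 18 * (g * h * (g * h)) + g * g * (g * g)) eq ⟨
      (+ 27 * (h * h * (h * h)) - g * g * (g * g)) + + 18 * (g * h * (g * h)) + g * g * (g * g)
        ≡⟨ collect g h ⟩
      + 3 * (+ 9 * (h * h * (h * h)) + + 6 * (g * g) * (h * h)) + + 0 ∎))
    where
    open ≡-Reasoning
    split-off : ∀ X g h → X * X + g * g * (g * g) ≡ (X * X - + 18 * (g * h * (g * h))) + + 18 * (g * h * (g * h)) + g * g * (g * g)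
    split-off = solve-∀
    collect : ∀ g h → (+ 27 * (h * h * (h * h)) - g * g * (g * g)) + + 18 * (g * h * (g * h)) + g * g * (g * g)
                      ≡ + 3 * (+ 9 * (h * h * (h * h)) + + 6 * (g * g) * (h * h)) + + 0
    collect = solve-∀

  g⁴-27h⁴≡X²-18g²h²⇒X²≡G : ∀ X g h → g * g * (g * g) - + 27 * (h * h * (h * h)) ≡ X * X - + 18 * (g * h * (g * h)) →
                            X * X ≡ G g h
  g⁴-27h⁴≡X²-18g²h²⇒X²≡G X g h eq = begin
    X * X                                                                   ≡⟨ split-off X g h ⟩
    (X * X - + 18 * (g * h * (g * h))) + + 18 * (g * h * (g * h))           ≡⟨ cong (_+ + 18 * (g * h * (g * h))) eq ⟨
    (g * g * (g * g) - + 27 * (h * h * (h * h))) + + 18 * (g * h * (g * h)) ≡⟨ collect g h ⟩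
    G g h                                                                   ∎
    where
    open ≡-Reasoning
    split-off : ∀ X g h → X * X ≡ (X * X - + 18 * (g * h * (g * h))) + + 18 * (g * h * (g * h))
    split-off = solve-∀
    collect : ∀ g h → (g * g * (g * g) - + 27 * (h * h * (h * h))) + + 18 * (g * h * (g * h))
                      ≡ g * g * (g * g) + + 18 * (g * g) * (h * h) - + 27 * (h * h * (h * h))
    collect = solve-∀

  SmallGSquare : ℕ → Set
  SmallGSquare N = ∃₂ λ g h → Coprime g (3 ℕ.* h) × h ≢ 0 × g ℕ.^ 4 ℕ.< N × ∃ λ X → X * X ≡ G (+ g) (+ h)

  small-G-square-weaken : ∀ {N N′} → N ℕ.≤ N′ → SmallGSquare N → SmallGSquare N′
  small-G-square-weaken N≤N′ (g , h , g⊥3h , h≢0 , g⁴<N , X²≡G) = g , h , g⊥3h , h≢0 , ℕ.<-≤-trans g⁴<N N≤N′ , X²≡G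

  G-square-from-factorisation : ∀ {A B c X : ℤ} → c ≢ 0ℤ → Coprime ∣ A ∣ ∣ B ∣ → 0ℤ ℤ.≤ A + B →
                                A * B ≡ + 27 * (c * c * (c * c)) → B - A ≡ X * X - + 18 * (c * c) →
                                SmallGSquare ∣ A + B ∣
  G-square-from-factorisation {A} {B} {c} {X} c≢0 A⊥B 0≤A+B AB≡ B-A≡ = g , h , g⊥3h , h≢0 , g⁴<∣A+B∣ , X , X²≡G splits
    where
    open Factorisation (factors-of-27c⁴ {A} {B} {c} c≢0 A⊥B 0≤A+B AB≡)
    instance
      27h⁴≢0 : NonZero (27 ℕ.* h ℕ.^ 4)
      27h⁴≢0 = ℕ.m*n≢0 27 (h ℕ.^ 4) {{_}} {{ℕ.m^n≢0 h 4 {{ℕ.≢-nonZero h≢0}}}}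
    g⁴<∣A+B∣ : g ℕ.^ 4 ℕ.< ∣ A + B ∣
    g⁴<∣A+B∣ = subst (g ℕ.^ 4 ℕ.<_) (sym ∣A+B∣≡) (ℕ.m<m+n (g ℕ.^ 4) (ℕ.>-nonZero⁻¹ (27 ℕ.* h ℕ.^ 4)))
    Gg = + g
    Hh = + h
    B-A≡′ : B - A ≡ X * X - + 18 * (Gg * Hh * (Gg * Hh))
    B-A≡′ = trans B-A≡ (cong (λ y → X * X - + 18 * y) c²≡)
    3∤g : ¬ (Gg ≡ 0 mod 3)
    3∤g g≡0 = 3≢1 (g⊥3h (≡0-mod⇒∣ g≡0 , ℕ.∣m⇒∣m*n h ℕ.∣-refl))
      where
      3≢1 : 3 ≢ 1
      3≢1 ()
    X²≡G : FourthPowerSplitℤ A B g h → X * X ≡ G Gg Hh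
    X²≡G (inj₁ (A≡ , B≡)) = ⊥-elim (27h⁴-g⁴≢X²-18g²h² X Gg Hh 3∤g (trans (sym (cong₂ _-_ B≡ A≡)) B-A≡′))
    X²≡G (inj₂ (A≡ , B≡)) = g⁴-27h⁴≡X²-18g²h²⇒X²≡G X Gg Hh (trans (sym (cong₂ _-_ B≡ A≡)) B-A≡′)

  F-square-from-factorisation : ∀ {A B c Y : ℤ} → c ≢ 0ℤ → Coprime ∣ A ∣ ∣ B ∣ → 0ℤ ℤ.≤ A + B →
                                A * B ≡ + 27 * (c * c * (c * c)) → A + B ≡ Y + + 9 * (c * c) →
                                ∃₂ λ m k → Coprime m k × k ≢ 0 × Y ≡ F (+ m) (+ k)
  F-square-from-factorisation {A} {B} {c} {Y} c≢0 A⊥B 0≤A+B AB≡ A+B≡ =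
    g , h , coprime-∣ʳ g⊥3h (ℕ.n∣m*n 3) , h≢0 , (begin
      Y                                                                ≡⟨ isolate Y (c * c) ⟩
      (Y + + 9 * (c * c)) - + 9 * (c * c)                              ≡⟨ cong₂ (λ s z → s - + 9 * z) (sym A+B≡) c²≡ ⟩
      (A + B) - + 9 * (Gg * Hh * (Gg * Hh))                            ≡⟨ cong (_- + 9 * (Gg * Hh * (Gg * Hh))) (split-sumℤ {g = g} {h} splits) ⟩
      Gg * Gg * (Gg * Gg) + + 27 * (Hh * Hh * (Hh * Hh)) - + 9 * (Gg * Hh * (Gg * Hh)) ≡⟨ collect Gg Hh ⟩
      F Gg Hh                                                          ∎)
    where
    open Factorisation (factors-of-27c⁴ {A} {B} {c} c≢0 A⊥B 0≤A+B AB≡)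
    open ≡-Reasoning
    Gg = + g
    Hh = + h
    isolate : ∀ y z → y ≡ (y + + 9 * z) - + 9 * z
    isolate = solve-∀
    collect : ∀ g h → g * g * (g * g) + + 27 * (h * h * (h * h)) - + 9 * (g * h * (g * h))
                      ≡ g * g * (g * g) - + 9 * (g * g) * (h * h) + + 27 * (h * h * (h * h))
    collect = solve-∀

  F-square⇒G-square-for-odd-k : ∀ {R m k} → Coprime m k → Coprime m 3 → k ≢ 0 → + k ≡ 1 mod 2 →
                                + R * + R ≡ F (+ m) (+ k) → SmallGSquare (4 ℕ.* R)
  F-square⇒G-square-for-odd-k {R} {m} {k} m⊥k m⊥3 k≢0 k-odd R²≡F =
    small-G-square-weaken (ℕ.≤-reflexive (cong ∣_∣ A+B≡))
      (G-square-from-factorisation {A} {B} {K} {+ 2 * M} K≢0 A⊥B (subst (0ℤ ℤ.≤_) (sym A+B≡) (ℤ.+≤+ z≤n)) AB≡ B-A≡)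
    where
    open ≡-Reasoning
    r = + R
    M = + m
    K = + k
    S = + 2 * (M * M) - + 9 * (K * K)
    A = + 2 * r - S
    B = + 2 * r + S
    K≢0 : K ≢ 0ℤ
    K≢0 K≡0 = k≢0 (ℤ.+-injective K≡0)
    AB≡ : A * B ≡ + 27 * (K * K * (K * K))
    AB≡ = begin
      A * B                                ≡⟨ difference-of-squares r S ⟩
      + 4 * (r * r) - S * S                ≡⟨ cong (λ y → + 4 * y - S * S) R²≡F ⟩
      + 4 * F M K - S * S                  ≡⟨ cong (_- S * S) (four-F≡square+27k⁴ M K) ⟩
      S * S + + 27 * (K * K * (K * K)) - S * S ≡⟨ cancel (S * S) _ ⟩
      + 27 * (K * K * (K * K))             ∎
      where
      difference-of-squares : ∀ r s → (+ 2 * r - s) * (+ 2 * r + s) ≡ + 4 * (r * r) - s * s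
      difference-of-squares = solve-∀
      cancel : ∀ x y → x + y - x ≡ y
      cancel = solve-∀
    A+B≡ : A + B ≡ + (4 ℕ.* R)
    A+B≡ = trans (sum r S) (sym (ℤ.pos-* 4 R))
      where
      sum : ∀ r s → (+ 2 * r - s) + (+ 2 * r + s) ≡ + 4 * r
      sum = solve-∀
    B-A≡ : B - A ≡ (+ 2 * M) * (+ 2 * M) - + 18 * (K * K)
    B-A≡ = difference r M K
      where
      difference : ∀ r m k → (+ 2 * r + (+ 2 * (m * m) - + 9 * (k * k))) - (+ 2 * r - (+ 2 * (m * m) - + 9 * (k * k)))
                             ≡ (+ 2 * m) * (+ 2 * m) - + 18 * (k * k)
      difference = solve-∀
    2m⊥3k : Coprime ∣ + 2 * M ∣ (3 ℕ.* k)
    2m⊥3k = coprime-*ˡ-abs (+ 2) M (coprime-*ʳ coprime-2-3 (Coprimality.sym (¬∣⇒coprime prime[2] (odd⇒¬2∣ k-odd))))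
                                   (coprime-*ʳ m⊥3 m⊥k)
    A⊥B : Coprime ∣ A ∣ ∣ B ∣
    A⊥B = coprime-via-combination {B - A} {A} {B} {K} ((+ 2 * M) * (+ 2 * M)) (- (+ 6) * K) (λ d∣A d∣B → ∣m∣n⇒∣m-n d∣B d∣A)
            (trans B-A≡ (regroup M K)) (coprime-*ˡ-abs (+ 2 * M) (+ 2 * M) 2m⊥3k 2m⊥3k) AB≡
      where
      regroup : ∀ m k → (+ 2 * m) * (+ 2 * m) - + 18 * (k * k) ≡ (+ 2 * m) * (+ 2 * m) + (- (+ 6) * k) * (+ 3 * k)
      regroup = solve-∀

  F-square⇒halves : ∀ {R m k y} → + m ≡ 1 mod 2 → + k ≡ + 2 * y + + 0 → + R * + R ≡ F (+ m) (+ k) →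
                    ∃₂ λ A B → A * B ≡ + 27 * (y * y * (y * y)) × A + B ≡ + R × B - A ≡ + m * + m - + 18 * (y * y)
  F-square⇒halves {R} {m} {k} {y} m-odd k≡2y R²≡F = halves (odd-square m-odd) (proj₂ (even-square (y , k≡2y)))
    where
    M = + m
    halves : M * M ≡ 1 mod 8 → + k * + k ≡ + 4 * (y * y) →
             ∃₂ λ A B → A * B ≡ + 27 * (y * y * (y * y)) × A + B ≡ + R × B - A ≡ M * M - + 18 * (y * y)
    halves (z , m²≡) k²≡ = halve-difference-of-odd-squares R-odd S-odd R²-S²≡
      where
      S-odd : M * M - + 18 * (y * y) ≡ 1 mod 2
      S-odd = + 4 * z - + 9 * (y * y) , trans (cong (_- + 18 * (y * y)) m²≡) (regroup z y)
        where
        regroup : ∀ z y → + 8 * z + + 1 - + 18 * (y * y) ≡ + 2 * (+ 4 * z - + 9 * (y * y)) + + 1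
        regroup = solve-∀
      R-odd : + R ≡ 1 mod 2
      R-odd with even-or-odd (+ R)
      ... | inj₂ R-odd  = R-odd
      ... | inj₁ R-even = ⊥-elim (even⇒¬square-odd R-even (W z y , trans R²≡F (trans (F-in-squares M (+ k) m²≡ k²≡) (parity z y))))
        where
        W : ℤ → ℤ → ℤ
        W z y = + 32 * z * z + + 8 * z - + 18 * (+ 8 * z + + 1) * (y * y) + + 216 * (y * y * (y * y))
        parity : ∀ z y → (+ 8 * z + + 1) * (+ 8 * z + + 1) - + 9 * (+ 8 * z + + 1) * (+ 4 * (y * y)) + + 27 * (+ 4 * (y * y) * (+ 4 * (y * y)))
                         ≡ + 2 * (+ 32 * z * z + + 8 * z - + 18 * (+ 8 * z + + 1) * (y * y) + + 216 * (y * y * (y * y))) + + 1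
        parity = solve-∀
      R²-S²≡ : + R * + R - (M * M - + 18 * (y * y)) * (M * M - + 18 * (y * y)) ≡ + 4 * (+ 27 * (y * y * (y * y)))
      R²-S²≡ = trans (cong (_- (M * M - + 18 * (y * y)) * (M * M - + 18 * (y * y))) (trans R²≡F (F-in-squares M (+ k) refl k²≡)))
                     (complete-square (M * M) y)
        where
        complete-square : ∀ u y → (u * u - + 9 * u * (+ 4 * (y * y)) + + 27 * (+ 4 * (y * y) * (+ 4 * (y * y))))
                                    - (u - + 18 * (y * y)) * (u - + 18 * (y * y))
                                  ≡ + 4 * (+ 27 * (y * y * (y * y)))
        complete-square = solve-∀

  F-square⇒G-square-for-even-k : ∀ {R m k} → Coprime m k → Coprime m 3 → k ≢ 0 → + m ≡ 1 mod 2 → + k ≡ 0 mod 2 →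
                                 + R * + R ≡ F (+ m) (+ k) → SmallGSquare (4 ℕ.* R)
  F-square⇒G-square-for-even-k {R} {m} {k} m⊥k m⊥3 k≢0 m-odd (y , k≡2y) R²≡F =
    let A , B , AB≡ , A+B≡ , B-A≡ = F-square⇒halves {R} {m} {k} {y} m-odd k≡2y R²≡F
    in  small-G-square-weaken (subst (ℕ._≤ 4 ℕ.* R) (sym (cong ∣_∣ A+B≡)) (ℕ.m≤n*m R 4))
          (G-square-from-factorisation {A} {B} {y} {M} y≢0 (A⊥B A B AB≡ B-A≡) (subst (0ℤ ℤ.≤_) (sym A+B≡) (ℤ.+≤+ z≤n)) AB≡ B-A≡)
    where
    M = + m
    y≢0 : y ≢ 0ℤ
    y≢0 refl = k≢0 (ℤ.+-injective k≡2y)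
    m⊥3y : Coprime m (3 ℕ.* ∣ y ∣)
    m⊥3y = coprime-*ʳ m⊥3 (coprime-∣ʳ m⊥k (∣⇒∣ᵤ (divides (+ 2) (trans k≡2y (reorder y)))))
      where
      reorder : ∀ y → + 2 * y + + 0 ≡ + 2 * y
      reorder = solve-∀
    A⊥B : ∀ A B → A * B ≡ + 27 * (y * y * (y * y)) → B - A ≡ M * M - + 18 * (y * y) → Coprime ∣ A ∣ ∣ B ∣
    A⊥B A B AB≡ B-A≡ = coprime-via-combination {B - A} {A} {B} {y} (M * M) (- (+ 6) * y) (λ d∣A d∣B → ∣m∣n⇒∣m-n d∣B d∣A)
                         (trans B-A≡ (regroup M y)) (coprime-*ˡ-abs M M m⊥3y m⊥3y) AB≡
      where
      regroup : ∀ m y → m * m - + 18 * (y * y) ≡ m * m + (- (+ 6) * y) * (+ 3 * y)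
      regroup = solve-∀

  F-square⇒small-G-square : ∀ {R m k} → Coprime m k → k ≢ 0 → + R * + R ≡ F (+ m) (+ k) → SmallGSquare (4 ℕ.* R)
  F-square⇒small-G-square {R} {m} {k} m⊥k k≢0 R²≡F =
    [ (λ k-even → F-square⇒G-square-for-even-k {R} m⊥k m⊥3 k≢0 (F-square⇒odd {R} m⊥k R²≡F) k-even R²≡F)
    , (λ k-odd → F-square⇒G-square-for-odd-k {R} m⊥k m⊥3 k≢0 k-odd R²≡F)
    ]′ (even-or-odd (+ k))
    where
    m⊥3 : Coprime m 3
    m⊥3 = F-square⇒coprime-3 {R} m⊥k R²≡F

  G-square⇒parities : ∀ {g h X} → Coprime g h → X * X ≡ G (+ g) (+ h) → + g ≡ 1 mod 2 × + h ≡ 0 mod 2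
  G-square⇒parities {g} {h} {X} g⊥h X²≡G = from-parities (even-or-odd (+ g)) (even-or-odd (+ h))
    where
    from-parities : + g ≡ 0 mod 2 ⊎ + g ≡ 1 mod 2 → + h ≡ 0 mod 2 ⊎ + h ≡ 1 mod 2 → + g ≡ 1 mod 2 × + h ≡ 0 mod 2
    from-parities (inj₂ g-odd)  (inj₁ h-even) = g-odd , h-even
    from-parities (inj₁ g-even) (inj₁ h-even) = ⊥-elim (coprime⇒¬both-even g⊥h g-even h-even)
    from-parities (inj₁ g-even) (inj₂ h-odd) =
      let x , g²≡ = even-square g-even
          z , h²≡ = odd-square h-odd
      in  case square-residue-mod-8 X (s≤s (s≤s (s≤s (s≤s (s≤s (s≤s z≤n))))))
                 (W x z , trans X²≡G (trans (G-in-squares (+ g) (+ h) g²≡ h²≡) (reduce x z))) of λ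
            { (inj₁ ()) ; (inj₂ (inj₁ ())) ; (inj₂ (inj₂ ())) }
      where
      W : ℤ → ℤ → ℤ
      W x z = + 2 * (x * x * (x * x)) + + 72 * (x * x) * z + + 9 * (x * x) - + 216 * (z * z) - + 54 * z - + 4
      reduce : ∀ x z → + 4 * (x * x) * (+ 4 * (x * x)) + + 18 * (+ 4 * (x * x)) * (+ 8 * z + + 1) - + 27 * ((+ 8 * z + + 1) * (+ 8 * z + + 1))
                     ≡ + 8 * (+ 2 * (x * x * (x * x)) + + 72 * (x * x) * z + + 9 * (x * x) - + 216 * (z * z) - + 54 * z - + 4) + + 5
      reduce = solve-∀
    from-parities (inj₂ g-odd) (inj₂ h-odd) =
      let a , g²≡ = odd-square g-odd
          b , h²≡ = odd-square h-odd
      in  ⊥-elim (square≢16q+8 X (Z a b) (trans X²≡G (trans (G-in-squares (+ g) (+ h) g²≡ h²≡) (reduce a b))))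
      where
      Z : ℤ → ℤ → ℤ
      Z a b = + 4 * a * a + + 10 * a + + 72 * a * b - + 18 * b - + 108 * b * b - + 1
      reduce : ∀ a b → (+ 8 * a + + 1) * (+ 8 * a + + 1) + + 18 * (+ 8 * a + + 1) * (+ 8 * b + + 1) - + 27 * ((+ 8 * b + + 1) * (+ 8 * b + + 1))
                     ≡ + 16 * (+ 4 * a * a + + 10 * a + + 72 * a * b - + 18 * b - + 108 * b * b - + 1) + + 8
      reduce = solve-∀

  G-square⇒halves : ∀ {g h X} → + g ≡ 1 mod 2 → + h ≡ 0 mod 2 → X * X ≡ G (+ g) (+ h) →
                    ∃₂ λ A B → A * B ≡ + 27 * (+ h * + h * (+ h * + h)) × A + B ≡ + g * + g + + 9 * (+ h * + h)
  G-square⇒halves {g} {h} {X} g-odd h-even X²≡G =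
    let A , B , AB≡ , A+B≡ , _ = halves (odd-square g-odd) (even-square h-even) in A , B , AB≡ , A+B≡
    where
    Gg = + g
    Hh = + h
    T = Gg * Gg + + 9 * (Hh * Hh)
    halves : Gg * Gg ≡ 1 mod 8 → (∃ λ y → Hh * Hh ≡ + 4 * (y * y)) →
             ∃₂ λ A B → A * B ≡ + 27 * (Hh * Hh * (Hh * Hh)) × A + B ≡ T × B - A ≡ X
    halves (z , g²≡) (y , h²≡) = halve-difference-of-odd-squares T-odd X-odd T²-X²≡
      where
      T-odd : T ≡ 1 mod 2
      T-odd = + 4 * z + + 18 * (y * y) , trans (cong₂ (λ u v → u + + 9 * v) g²≡ h²≡) (regroup z y)
        where
        regroup : ∀ z y → + 8 * z + + 1 + + 9 * (+ 4 * (y * y)) ≡ + 2 * (+ 4 * z + + 18 * (y * y)) + + 1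
        regroup = solve-∀
      X-odd : X ≡ 1 mod 2
      X-odd with even-or-odd X
      ... | inj₂ X-odd  = X-odd
      ... | inj₁ X-even = ⊥-elim (even⇒¬square-odd X-even (W z y , trans X²≡G (trans (G-in-squares Gg Hh g²≡ h²≡) (parity z y))))
        where
        W : ℤ → ℤ → ℤ
        W z y = + 32 * z * z + + 8 * z + + 36 * (+ 8 * z + + 1) * (y * y) - + 216 * (y * y * (y * y))
        parity : ∀ z y → (+ 8 * z + + 1) * (+ 8 * z + + 1) + + 18 * (+ 8 * z + + 1) * (+ 4 * (y * y)) - + 27 * (+ 4 * (y * y) * (+ 4 * (y * y)))
                         ≡ + 2 * (+ 32 * z * z + + 8 * z + + 36 * (+ 8 * z + + 1) * (y * y) - + 216 * (y * y * (y * y))) + + 1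
        parity = solve-∀
      T²-X²≡ : T * T - X * X ≡ + 4 * (+ 27 * (Hh * Hh * (Hh * Hh)))
      T²-X²≡ = trans (cong (λ z → T * T - z) X²≡G) (trans (cong (_- G Gg Hh) (sym (G+108h⁴≡square Gg Hh))) (cancel (G Gg Hh) _))
        where
        cancel : ∀ x y → x + y - x ≡ y
        cancel = solve-∀

  G-square⇒F-square : ∀ {g h X} → Coprime g (3 ℕ.* h) → h ≢ 0 → X * X ≡ G (+ g) (+ h) →
                      ∃₂ λ m k → Coprime m k × k ≢ 0 × + g * + g ≡ F (+ m) (+ k)
  G-square⇒F-square {g} {h} {X} g⊥3h h≢0 X²≡G =
    let g-odd , h-even = G-square⇒parities {X = X} (coprime-∣ʳ g⊥3h (ℕ.n∣m*n 3 {h})) X²≡G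
        A , B , AB≡ , A+B≡ = G-square⇒halves {X = X} g-odd h-even X²≡G
    in  F-square-from-factorisation {A} {B} {Hh} {Gg * Gg} H≢0 (A⊥B A B AB≡ A+B≡)
          (subst (0ℤ ℤ.≤_) (sym (trans A+B≡ T≡ℕ)) (ℤ.+≤+ z≤n)) AB≡ A+B≡
    where
    Gg = + g
    Hh = + h
    H≢0 : Hh ≢ 0ℤ
    H≢0 H≡0 = h≢0 (ℤ.+-injective H≡0)
    T≡ℕ : Gg * Gg + + 9 * (Hh * Hh) ≡ + (g ℕ.* g ℕ.+ 9 ℕ.* (h ℕ.* h))
    T≡ℕ = sym (trans (ℤ.pos-+ (g ℕ.* g) (9 ℕ.* (h ℕ.* h)))
                     (cong₂ _+_ (ℤ.pos-* g g) (trans (ℤ.pos-* 9 (h ℕ.* h)) (cong (+ 9 *_) (ℤ.pos-* h h)))))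
    A⊥B : ∀ A B → A * B ≡ + 27 * (Hh * Hh * (Hh * Hh)) → A + B ≡ Gg * Gg + + 9 * (Hh * Hh) → Coprime ∣ A ∣ ∣ B ∣
    A⊥B A B AB≡ A+B≡ = coprime-via-combination {A + B} {A} {B} {Hh} (Gg * Gg) (+ 3 * Hh) ∣m∣n⇒∣m+n
                         (trans A+B≡ (regroup Gg Hh)) (coprime-*ˡ-abs Gg Gg g⊥3h g⊥3h) AB≡
      where
      regroup : ∀ g h → g * g + + 9 * (h * h) ≡ g * g + (+ 3 * h) * (+ 3 * h)
      regroup = solve-∀

  F-square⇒2≤ : ∀ {R m k} → k ≢ 0 → + R * + R ≡ F (+ m) (+ k) → 2 ℕ.≤ R
  F-square⇒2≤ {R} {m} {k} k≢0 R²≡F = 27≤4R²⇒2≤R R (subst (27 ℕ.≤_) (sym 4R²≡) (ℕ.≤-trans 27≤27k⁴ (ℕ.m≤n+m _ (∣ S ∣ ℕ.* ∣ S ∣))))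
    where
    M = + m
    K = + k
    S = + 2 * (M * M) - + 9 * (K * K)
    4R²≡ : 4 ℕ.* (R ℕ.* R) ≡ ∣ S ∣ ℕ.* ∣ S ∣ ℕ.+ 27 ℕ.* k ℕ.^ 4
    4R²≡ = ℤ.+-injective (begin
      + (4 ℕ.* (R ℕ.* R))                      ≡⟨ trans (ℤ.pos-* 4 (R ℕ.* R)) (cong (+ 4 *_) (ℤ.pos-* R R)) ⟩
      + 4 * (+ R * + R)                        ≡⟨ cong (+ 4 *_) R²≡F ⟩
      + 4 * F M K                              ≡⟨ four-F≡square+27k⁴ M K ⟩
      S * S + + 27 * (K * K * (K * K))         ≡⟨ cong₂ _+_ (sym (abs-square S)) (27c⁴-as-natural K) ⟩
      + ∣ S ∣ * + ∣ S ∣ + + (27 ℕ.* k ℕ.^ 4)   ≡⟨ cong (_+ + (27 ℕ.* k ℕ.^ 4)) (ℤ.pos-* ∣ S ∣ ∣ S ∣) ⟨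
      + (∣ S ∣ ℕ.* ∣ S ∣) + + (27 ℕ.* k ℕ.^ 4) ≡⟨ ℤ.pos-+ (∣ S ∣ ℕ.* ∣ S ∣) (27 ℕ.* k ℕ.^ 4) ⟨
      + (∣ S ∣ ℕ.* ∣ S ∣ ℕ.+ 27 ℕ.* k ℕ.^ 4)   ∎)
      where open ≡-Reasoning
    27≤27k⁴ : 27 ℕ.≤ 27 ℕ.* k ℕ.^ 4
    27≤27k⁴ = ℕ.m≤m*n 27 (k ℕ.^ 4) {{ℕ.m^n≢0 k 4 {{ℕ.≢-nonZero k≢0}}}}
    27≤4R²⇒2≤R : ∀ R → 27 ℕ.≤ 4 ℕ.* (R ℕ.* R) → 2 ℕ.≤ R
    27≤4R²⇒2≤R 0 ()
    27≤4R²⇒2≤R 1 (s≤s (s≤s (s≤s (s≤s ()))))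
    27≤4R²⇒2≤R (suc (suc _)) _ = s≤s (s≤s z≤n)

  g⁴<4R⇒g<R : ∀ {g R} → 2 ℕ.≤ R → g ℕ.^ 4 ℕ.< 4 ℕ.* R → g ℕ.< R
  g⁴<4R⇒g<R {g} {R} 2≤R g⁴<4R = ℕ.≰⇒> λ R≤g → ℕ.<⇒≱ g⁴<4R (begin
    4 ℕ.* R          ≤⟨ ℕ.*-monoˡ-≤ R (ℕ.≤-trans (ℕ.m≤m+n 4 4) (ℕ.^-monoˡ-≤ 3 2≤R)) ⟩
    R ℕ.^ 3 ℕ.* R    ≡⟨ ℕ.*-comm (R ℕ.^ 3) R ⟩
    R ℕ.^ 4          ≤⟨ ℕ.^-monoˡ-≤ 4 R≤g ⟩
    g ℕ.^ 4          ∎)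
    where open ℕ.≤-Reasoning

  primitive-F-not-square : ∀ R {m k} → Coprime m k → k ≢ 0 → + R * + R ≢ F (+ m) (+ k)
  primitive-F-not-square = <-rec NoPrimitiveSolution descent
    where
    NoPrimitiveSolution : ℕ → Set
    NoPrimitiveSolution R = ∀ {m k} → Coprime m k → k ≢ 0 → + R * + R ≢ F (+ m) (+ k)
    descent : ∀ R → (∀ {g} → g ℕ.< R → NoPrimitiveSolution g) → NoPrimitiveSolution R
    descent R smaller {m} {k} m⊥k k≢0 R²≡F = via-G (F-square⇒small-G-square {R} m⊥k k≢0 R²≡F)
      where
      via-G : SmallGSquare (4 ℕ.* R) → ⊥
      via-G (g , h , g⊥3h , h≢0 , g⁴<4R , X , X²≡G) = back-to-F (G-square⇒F-square {X = X} g⊥3h h≢0 X²≡G)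
        where
        back-to-F : ∃₂ (λ m′ k′ → Coprime m′ k′ × k′ ≢ 0 × + g * + g ≡ F (+ m′) (+ k′)) → ⊥
        back-to-F (m′ , k′ , m′⊥k′ , k′≢0 , g²≡F) = smaller {g} (g⁴<4R⇒g<R {g} (F-square⇒2≤ {R} {m} k≢0 R²≡F) g⁴<4R) m′⊥k′ k′≢0 g²≡F

  F-square⇒primitive-F-square : ∀ {R m k} → k ≢ 0 → + R * + R ≡ F (+ m) (+ k) →
                                ∃₂ λ R′ m′ → ∃ λ k′ → Coprime m′ k′ × k′ ≢ 0 × + R′ * + R′ ≡ F (+ m′) (+ k′)
  F-square⇒primitive-F-square {R} {m} {k} k≢0 R²≡F =
    let R′ , R′²≡F′ = square-over-fourth-power {R} d R²≡F′D⁴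
    in  R′ , m′ , k′ , coprime-/gcd m k , k′≢0 , R′²≡F′
    where
    open ≡-Reasoning
    d = gcd m k
    instance
      d≢0 : NonZero d
      d≢0 = ℕ.≢-nonZero (gcd[m,n]≢0 m k (inj₂ k≢0))
    m′ = m ℕ./ d
    k′ = k ℕ./ d
    D = + d
    lift : ∀ {x} → x ℕ./ d ℕ.* d ≡ x → + x ≡ + (x ℕ./ d) * D
    lift {x} x≡ = trans (cong +_ (sym x≡)) (ℤ.pos-* (x ℕ./ d) d)
    k′≢0 : k′ ≢ 0
    k′≢0 k′≡0 = k≢0 (trans (sym (m/n*n≡m (gcd[m,n]∣n m k))) (cong (ℕ._* d) k′≡0))
    R²≡F′D⁴ : + R * + R ≡ F (+ m′) (+ k′) * (D * D * (D * D))
    R²≡F′D⁴ = begin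
      + R * + R                             ≡⟨ R²≡F ⟩
      F (+ m) (+ k)                         ≡⟨ cong₂ F (lift (m/n*n≡m (gcd[m,n]∣m m k))) (lift (m/n*n≡m (gcd[m,n]∣n m k))) ⟩
      F (+ m′ * D) (+ k′ * D)               ≡⟨ F-homogeneous (+ m′) (+ k′) D ⟩
      F (+ m′) (+ k′) * (D * D * (D * D))   ∎

  F-not-square : ∀ m k → k ≢ 0ℤ → ¬ ∃ λ r → r * r ≡ F m k
  F-not-square m k k≢0 (r , r²≡F) =
    let R′ , m′ , k′ , m′⊥k′ , k′≢0 , R′²≡F′ = F-square⇒primitive-F-square {∣ r ∣} {∣ m ∣} {∣ k ∣} ∣k∣≢0 ∣r∣²≡F
    in  primitive-F-not-square R′ m′⊥k′ k′≢0 R′²≡F′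
    where
    ∣k∣≢0 : ∣ k ∣ ≢ 0
    ∣k∣≢0 ∣k∣≡0 = k≢0 (ℤ.∣i∣≡0⇒i≡0 ∣k∣≡0)
    ∣r∣²≡F : + ∣ r ∣ * + ∣ r ∣ ≡ F (+ ∣ m ∣) (+ ∣ k ∣)
    ∣r∣²≡F = trans (abs-square r) (trans r²≡F (F-in-squares m k (sym (abs-square m)) (sym (abs-square k))))

module RationalCurve where

  open import Data.Product using (∃; ∃₂; _,_; _×_)
  open import Data.Sum using (inj₁; inj₂)
  open import Relation.Binary.PropositionalEquality
  open import Relation.Nullary using (yes; no; contradiction)

  open import Data.Nat using (suc)
  open import Data.Nat.Coprimality using (Coprime)
  open import Data.Integer as ℤ using (ℤ; +_; _+_; _*_; _-_; -_; ∣_∣; 0ℤ)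
  import Data.Integer.Properties as ℤ
  open import Data.Integer.Tactic.RingSolver using (solve-∀)
  open import Data.Rational as ℚ using (ℚ; mkℚ; 0ℚ; 1ℚ; toℚᵘ)
  import Data.Rational.Properties as ℚ
  open import Data.Rational.Unnormalised as ℚᵘ using (ℚᵘ; mkℚᵘ; *≡*) renaming (_≃_ to _≃ᵘ_)
  import Data.Rational.Unnormalised.Properties as ℚᵘ

  open import Defs
  open Quartics using (F)

  numerator : ℚ → ℚ
  numerator t = (+ 3) ℚ./ 1 ℚ.* t ℚ.* t ℚ.- 1ℚ

  denominator : ℚ → ℚ
  denominator t = ((+ 3) ℚ./ 1 ℚ.* t ℚ.+ 1ℚ) ℚ.* (t ℚ.- 1ℚ)

  numeratorᵘ : ℚᵘ → ℚᵘ
  numeratorᵘ t = mkℚᵘ (+ 3) 0 ℚᵘ.* t ℚᵘ.* t ℚᵘ.- ℚᵘ.1ℚᵘ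

  denominatorᵘ : ℚᵘ → ℚᵘ
  denominatorᵘ t = (mkℚᵘ (+ 3) 0 ℚᵘ.* t ℚᵘ.+ ℚᵘ.1ℚᵘ) ℚᵘ.* (t ℚᵘ.- ℚᵘ.1ℚᵘ)

  toℚᵘ-numerator : ∀ t → toℚᵘ (numerator t) ≃ᵘ numeratorᵘ (toℚᵘ t)
  toℚᵘ-numerator t = ℚᵘ.≃-trans (ℚ.toℚᵘ-homo-+ ((+ 3) ℚ./ 1 ℚ.* t ℚ.* t) (ℚ.- 1ℚ))
    (ℚᵘ.+-cong (ℚᵘ.≃-trans (ℚ.toℚᵘ-homo-* ((+ 3) ℚ./ 1 ℚ.* t) t) (ℚᵘ.*-cong (ℚ.toℚᵘ-homo-* ((+ 3) ℚ./ 1) t) ℚᵘ.≃-refl))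
               ℚᵘ.≃-refl)

  toℚᵘ-denominator : ∀ t → toℚᵘ (denominator t) ≃ᵘ denominatorᵘ (toℚᵘ t)
  toℚᵘ-denominator t = ℚᵘ.≃-trans (ℚ.toℚᵘ-homo-* ((+ 3) ℚ./ 1 ℚ.* t ℚ.+ 1ℚ) (t ℚ.- 1ℚ))
    (ℚᵘ.*-cong (ℚᵘ.≃-trans (ℚ.toℚᵘ-homo-+ ((+ 3) ℚ./ 1 ℚ.* t) 1ℚ) (ℚᵘ.+-cong (ℚ.toℚᵘ-homo-* ((+ 3) ℚ./ 1) t) ℚᵘ.≃-refl))
               (ℚ.toℚᵘ-homo-+ t (ℚ.- 1ℚ)))

  ⊘-*-cancel : ∀ p q → q ≢ 0ℚ → p ⊘ q ℚ.* q ≡ p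
  ⊘-*-cancel p q q≢0 with q ℚ.≟ 0ℚ
  ... | yes q≡0 = contradiction q≡0 q≢0
  ... | no _ = begin
    p ℚ.* ℚ.1/ q ℚ.* q    ≡⟨ ℚ.*-assoc p (ℚ.1/ q) q ⟩
    p ℚ.* (ℚ.1/ q ℚ.* q)  ≡⟨ cong (p ℚ.*_) (ℚ.*-inverseˡ q) ⟩
    p ℚ.* 1ℚ              ≡⟨ ℚ.*-identityʳ p ⟩
    p                     ∎
    where
    open ≡-Reasoning
    instance
      q≢0′ : ℚ.NonZero q
      q≢0′ = ℚ.≢-nonZero q≢0

  cleared-denominator : ∀ q t → denominator t ≢ 0ℚ → q ℚ.* q ≡ (+ 2) ℚ./ 3 ℚ.* (numerator t ⊘ denominator t) →
                        q ℚ.* q ℚ.* denominator t ≡ (+ 2) ℚ./ 3 ℚ.* numerator t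
  cleared-denominator q t den≢0 q²≡ = begin
    q ℚ.* q ℚ.* denominator t                                    ≡⟨ cong (ℚ._* denominator t) q²≡ ⟩
    (+ 2) ℚ./ 3 ℚ.* (numerator t ⊘ denominator t) ℚ.* denominator t ≡⟨ ℚ.*-assoc ((+ 2) ℚ./ 3) (numerator t ⊘ denominator t) (denominator t) ⟩
    (+ 2) ℚ./ 3 ℚ.* (numerator t ⊘ denominator t ℚ.* denominator t) ≡⟨ cong ((+ 2) ℚ./ 3 ℚ.*_) (⊘-*-cancel (numerator t) (denominator t) den≢0) ⟩
    (+ 2) ℚ./ 3 ℚ.* numerator t                                  ∎
    where open ≡-Reasoning

  curve-equation : ∀ a b m n .{c : Coprime ∣ a ∣ (suc b)} .{d : Coprime ∣ m ∣ (suc n)} →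
                   mkℚ m n d ℚ.* mkℚ m n d ℚ.* denominator (mkℚ a b c) ≡ (+ 2) ℚ./ 3 ℚ.* numerator (mkℚ a b c) →
                   + 3 * (m * m) * ((+ 3 * a + + suc b) * (a - + suc b)) ≡ + 2 * (+ suc n * + suc n) * (+ 3 * (a * a) - + suc b * + suc b)
  curve-equation a b m n {c} {d} eq with ℚᵘ.≃-trans (ℚᵘ.≃-sym lhs) (ℚᵘ.≃-trans (ℚ.toℚᵘ-cong eq) rhs)
    where
    t = mkℚ a b c
    q = mkℚ m n d
    lhs : toℚᵘ (q ℚ.* q ℚ.* denominator t) ≃ᵘ (toℚᵘ q ℚᵘ.* toℚᵘ q) ℚᵘ.* denominatorᵘ (toℚᵘ t)
    lhs = ℚᵘ.≃-trans (ℚ.toℚᵘ-homo-* (q ℚ.* q) (denominator t)) (ℚᵘ.*-cong (ℚ.toℚᵘ-homo-* q q) (toℚᵘ-denominator t))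
    rhs : toℚᵘ ((+ 2) ℚ./ 3 ℚ.* numerator t) ≃ᵘ mkℚᵘ (+ 2) 2 ℚᵘ.* numeratorᵘ (toℚᵘ t)
    rhs = ℚᵘ.≃-trans (ℚ.toℚᵘ-homo-* ((+ 2) ℚ./ 3) (numerator t)) (ℚᵘ.*-cong ℚᵘ.≃-refl (toℚᵘ-numerator t))
  -- cross-multiplied is the defining equation of ℚᵘ equality, with ℚᵘ products and sums unfolded as they compute.
  ... | *≡* cross-multiplied =
    ℤ.*-cancelʳ-≡ _ _ (B * B) (trans (sym (left a B m)) (trans cross-multiplied (right a B N)))
    where
    B = + suc b
    N = + suc n
    left : ∀ a B m → (m * m) * (((+ 3 * a) * + 1 + + 1 * (+ 1 * B)) * (a * + 1 + (- + 1) * B)) * (+ 3 * (((+ 1 * B) * B) * + 1))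
                     ≡ (+ 3 * (m * m) * ((+ 3 * a + B) * (a - B))) * (B * B)
    left = solve-∀
    right : ∀ a B N → (+ 2 * (((+ 3 * a) * a) * + 1 + (- + 1) * ((+ 1 * B) * B))) * ((N * N) * (((+ 1 * B) * + 1) * (B * + 1)))
                      ≡ (+ 2 * (N * N) * (+ 3 * (a * a) - B * B)) * (B * B)
    right = solve-∀

  mkℚ≡1 : ∀ a b .{c : Coprime ∣ a ∣ (suc b)} → a - + suc b ≡ 0ℤ → mkℚ a b c ≡ 1ℚ
  mkℚ≡1 a b a-B≡0 = ℚ.toℚᵘ-injective (*≡* (trans (shift a (+ suc b)) (trans (cong (_+ + 1 * + suc b) a-B≡0) (ℤ.+-identityˡ _))))
    where
    shift : ∀ a B → a * + 1 ≡ (a - B) + + 1 * B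
    shift = solve-∀

  mkℚ≡-1/3 : ∀ a b .{c : Coprime ∣ a ∣ (suc b)} → + 3 * a + + suc b ≡ 0ℤ → mkℚ a b c ≡ ℚ.- ((+ 1) ℚ./ 3)
  mkℚ≡-1/3 a b 3a+B≡0 = ℚ.toℚᵘ-injective (*≡* (trans (shift a (+ suc b)) (trans (cong (_+ - + 1 * + suc b) 3a+B≡0) (ℤ.+-identityˡ _))))
    where
    shift : ∀ a B → a * + 3 ≡ (+ 3 * a + B) + - + 1 * B
    shift = solve-∀

  denominator≢0 : ∀ a b .{c : Coprime ∣ a ∣ (suc b)} → mkℚ a b c ≢ 1ℚ → mkℚ a b c ≢ ℚ.- ((+ 1) ℚ./ 3) →
                  denominator (mkℚ a b c) ≢ 0ℚ
  denominator≢0 a b {c} t≢1 t≢-1/3 den≡0 with ℚᵘ.≃-trans (ℚᵘ.≃-sym (toℚᵘ-denominator (mkℚ a b c))) (ℚ.toℚᵘ-cong den≡0)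
  ... | *≡* cross-multiplied with ℤ.i*j≡0⇒i≡0∨j≡0 (+ 3 * a + B) (trans (sym (left a B)) (trans cross-multiplied (right B)))
    where
    B = + suc b
    left : ∀ a B → (((+ 3 * a) * + 1 + + 1 * (+ 1 * B)) * (a * + 1 + (- + 1) * B)) * + 1 ≡ (+ 3 * a + B) * (a - B)
    left = solve-∀
    right : ∀ B → + 0 * (((+ 1 * B) * + 1) * (B * + 1)) ≡ 0ℤ
    right = solve-∀
  ...   | inj₁ 3a+B≡0 = t≢-1/3 (mkℚ≡-1/3 a b 3a+B≡0)
  ...   | inj₂ a-B≡0  = t≢1 (mkℚ≡1 a b a-B≡0)

  curve-point⇒F-square : ∀ a B m N → + 3 * (m * m) * ((+ 3 * a + B) * (a - B)) ≡ + 2 * (N * N) * (+ 3 * (a * a) - B * B) →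
                         ∃ λ R → R * R ≡ F (+ 3 * m * (a - B)) (N * (a - B))
  curve-point⇒F-square a B m N curve = R , (begin
    R * R                                                  ≡⟨ identity a B m N ⟩
    F M K + (- + 9 * ((a - B) * (a - B)) * (N * N)) * (lhs - rhs)  ≡⟨ cong (λ z → F M K + (- + 9 * ((a - B) * (a - B)) * (N * N)) * z) lhs-rhs≡0 ⟩
    F M K + (- + 9 * ((a - B) * (a - B)) * (N * N)) * 0ℤ   ≡⟨ vanish (F M K) (- + 9 * ((a - B) * (a - B)) * (N * N)) ⟩
    F M K                                                  ∎)
    where
    open ≡-Reasoning
    R = + 3 * ((+ 3 * a - B) * (N * N) - + 3 * (m * m) * (a - B)) * (a - B)
    M = + 3 * m * (a - B)
    K = N * (a - B)
    lhs = + 3 * (m * m) * ((+ 3 * a + B) * (a - B))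
    rhs = + 2 * (N * N) * (+ 3 * (a * a) - B * B)
    lhs-rhs≡0 : lhs - rhs ≡ 0ℤ
    lhs-rhs≡0 = trans (cong (_- rhs) curve) (ℤ.+-inverseʳ rhs)
    identity : ∀ a B m N →
      (+ 3 * ((+ 3 * a - B) * (N * N) - + 3 * (m * m) * (a - B)) * (a - B)) * (+ 3 * ((+ 3 * a - B) * (N * N) - + 3 * (m * m) * (a - B)) * (a - B))
      ≡ (+ 3 * m * (a - B)) * (+ 3 * m * (a - B)) * ((+ 3 * m * (a - B)) * (+ 3 * m * (a - B)))
          - + 9 * ((+ 3 * m * (a - B)) * (+ 3 * m * (a - B))) * ((N * (a - B)) * (N * (a - B)))
          + + 27 * ((N * (a - B)) * (N * (a - B)) * ((N * (a - B)) * (N * (a - B))))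
        + (- + 9 * ((a - B) * (a - B)) * (N * N)) * (+ 3 * (m * m) * ((+ 3 * a + B) * (a - B)) - + 2 * (N * N) * (+ 3 * (a * a) - B * B))
    identity = solve-∀
    vanish : ∀ x y → x + y * 0ℤ ≡ x
    vanish = solve-∀

  rational-point⇒F-square : ∀ t q → t ≢ 1ℚ → t ≢ ℚ.- ((+ 1) ℚ./ 3) →
                            q ℚ.* q ≡ (+ 2) ℚ./ 3 ℚ.* (numerator t ⊘ denominator t) →
                            ∃₂ λ M K → K ≢ 0ℤ × ∃ λ R → R * R ≡ F M K
  rational-point⇒F-square t@(mkℚ a b a⊥b) q@(mkℚ m n m⊥n) t≢1 t≢-1/3 q²≡ =
    + 3 * m * (a - B) , N * (a - B) , K≢0 , curve-point⇒F-square a B m N curve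
    where
    B = + suc b
    N = + suc n
    curve : + 3 * (m * m) * ((+ 3 * a + B) * (a - B)) ≡ + 2 * (N * N) * (+ 3 * (a * a) - B * B)
    curve = curve-equation a b m n {a⊥b} {m⊥n} (cleared-denominator q t (denominator≢0 a b t≢1 t≢-1/3) q²≡)
    K≢0 : N * (a - B) ≢ 0ℤ
    K≢0 K≡0 with ℤ.i*j≡0⇒i≡0∨j≡0 N K≡0
    ... | inj₁ ()
    ... | inj₂ a-B≡0 = t≢1 (mkℚ≡1 a b a-B≡0)

open RationalCurve using (rational-point⇒F-square)
open Quartics using (F-not-square)

open import Defs
open import Data.Rational using (ℚ; _+_; _-_; _*_; -_; _/_; 1ℚ)
open import Data.Integer using (+_)
open import Data.Product using (∃; _,_)
open import Relation.Binary.PropositionalEquality using (_≡_; _≢_)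
open import Relation.Nullary using (¬_)

proposition19 : (t : ℚ) → t ≢ 1ℚ → t ≢ - ((+ 1) / 3) →
    ¬ (∃ λ (q : ℚ) → q * q ≡ ((+ 2) / 3) * (((+ 3) / 1 * t * t - 1ℚ) ⊘ ((((+ 3) / 1) * t + 1ℚ) * (t - 1ℚ))))
proposition19 t t≢1 t≢-1/3 (q , q²≡) =
  let M , K , K≢0 , F[M,K]-square = rational-point⇒F-square t q t≢1 t≢-1/3 q²≡
  in  F-not-square M K K≢0 F[M,K]-square
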